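{- Define \[ \psi(X)=\sum_{n=1}^{\infty}\frac{(-1)^{n-1}}{n}\hbar^{n-1}\mathbf{a}\mathbf{b}^{n}X^{n},\qquad \phi(X)=\sum_{n=1}^{\infty}\frac{(-1)^{n-1}}{n}\mathbf{a}^{n}\mathbf{b}X^{n}. \] Then \[ \psi(X)=\log_{\sqcup\!\sqcup_q}\!\left(\frac{1}{1-e_{\overline{1}}X}\right),\qquad \phi(X)=\log_{*_q}\!\left(\frac{1}{1-e_{\overline{1}}X}\right). \]
   Context: Let $\hbar$ be a formal variable, $\mathcal{C}=\mathbb{Q}[\hbar,\hbar^{ -1}]$, and $\mathfrak{H}=\mathcal{C}\langle \mathbf{a},\mathbf{b}\rangle$ the non-commutative polynomial ring over $\mathcal{C}$ in two indeterminates. Let $\widehat{\mathbb{N}}=\{\overline{1}\}\sqcup\mathbb{N}$, where $\overline{1}$ is a new symbol. Put $e_{\overline{1}}=\mathbf{a}\mathbf{b}$, $e_k=\mathbf{a}^{k-1}(\mathbf{a}+\hbar)\mathbf{b}$ for $k\ge 1$, and $e_{\overline{n}}=\mathbf{a}^n\mathbf{b}$ for $n\ge1$. Let $\widehat{\mathfrak{H}^1}$ be the $\mathcal{C}$-subalgebra of $\mathfrak{H}$ generated by $\{e_k\}_{k\in\widehat{\mathbb{N}}}$; it is freely generated by them and contains all $e_{\overline{n}}$ and all $\hbar^{n-1}\mathbf{a}\mathbf{b}^n$. Stuffle product: let $\mathfrak{z}$ be the $\mathcal{C}$-span of $\{e_k\}_{k\in\widehat{\mathbb{N}}}$ and $\circ_q$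 the symmetric $\mathcal{C}$-bilinear map $\mathfrak z\times\mathfrak z\to\mathfrak z$ with $e_{\overline1}\circ_q e_{\overline1}=e_2-\hbar e_{\overline1}$, $e_{\overline1}\circ_q e_k=e_k\circ_q e_{\overline1}=e_{k+1}$, $e_k\circ_q e_l=e_{k+l}+\hbar e_{k+l-1}$ ($k,l\ge1$). The stuffle product $*_q$ is the $\mathcal{C}$-bilinear product on $\widehat{\mathfrak{H}^1}$ with $1*_q w=w*_q1=w$ and $(e_kw)*_q(e_lw')=e_k(w*_q e_lw')+e_l(e_kw*_q w')+(e_k\circ_q e_l)(w*_q w')$ for $k,l\in\widehat{\mathbb N}$, $w,w'\in\widehat{\mathfrak H^1}$. Shuffle product: $\sqcup\!\sqcup_q$ is the $\mathcal{C}$-bilinear product on $\mathfrak H$ with $1\sqcup\!\sqcup_q w=w\sqcup\!\sqcup_q 1=w$, $(\mathbf a w)\sqcup\!\sqcup_q(\mathbf a w')=\mathbf a\big((\mathbf a w)\sqcup\!\sqcup_q w'+w\sqcup\!\sqcup_q(\mathbf a w')+\hbar\, w\sqcup\!\sqcup_q w'\big)$, $(\mathbf b w)\sqcup\!\sqcup_q w'=w\sqcup\!\sqcup_q(\mathbf b w')=\mathbf b(w\sqcup\!\sqcup_q w')$. Both products are commutative and associative. $X$ is a commuting formal variable; both products are extended $\mathcal{C}[[X]]$-linearly to $\mathfrak{H}[[X]]$ (resp. $\widehat{\mathfrak{H}^1}[[X]]$). For $f\in X\mathfrak{H}[[X]]$, $\log_{\sqcup\!\sqcup_q}(1+f)=\sum_{n\ge1}\frac{(-1)^{n-1}}{n}f^{\sqcup\!\sqcup_q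 n}$, where $f^{\sqcup\!\sqcup_q n}$ is the $n$-fold $\sqcup\!\sqcup_q$-power; $\log_{*_q}$ is defined likewise with $*_q$. Here $\frac{1}{1-e_{\overline1}X}=\sum_{n\ge0}e_{\overline1}^nX^n$ (ordinary concatenation powers). -}

module Defs where

open import Data.Nat using (ℕ; zero; suc; _+_; _∸_)
open import Data.Integer as ℤ using (ℤ; +_)
open import Data.Rational as ℚ using (ℚ; 0ℚ; 1ℚ)
open import Data.List using (List; []; _∷_; _++_; map; concatMap; upTo; replicate; foldr)
open import Data.List.Properties using (≡-dec)
open import Data.Product using (_×_; _,_)
open import Relation.Nullary using (yes; no)
open import Relation.Binary.Definitions using (DecidableEquality)
open import Relation.Binary.PropositionalEquality using (_≡_; refl)

-- Free C-modules, C = ℚ[ħ,ħ⁻¹], with basis W.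
-- An element is a finite formal sum of terms  q · ħ^k · w  (q ∈ ℚ, k ∈ ℤ, w ∈ W),
-- represented by a list of terms; two elements are equal iff all their
-- coefficients agree (see _≈_ below).

Lin : Set → Set
Lin W = List (ℚ × ℤ × W)

zeroL : {W : Set} → Lin W
zeroL = []

_⊕_ : {W : Set} → Lin W → Lin W → Lin W
_⊕_ = _++_

single : {W : Set} → W → Lin W
single w = (1ℚ , + 0 , w) ∷ []

scale : {W : Set} → ℚ → ℤ → Lin W → Lin W
scale q k = map (λ { (q' , k' , w) → (q ℚ.* q' , k ℤ.+ k' , w) })

linExt : {W V : Set} → (W → Lin V) → Lin W → Lin V
linExt f = concatMap (λ { (q , k , w) → scale q k (f w) })

bilin : {W V U : Set} → (W → V → Lin U) → Lin W → Lin V → Lin U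
bilin f p r = linExt (λ w → linExt (λ v → f w v) r) p

coeff : {W : Set} → DecidableEquality W → Lin W → ℤ → W → ℚ
coeff _≟_ [] k w = 0ℚ
coeff _≟_ ((q , k' , w') ∷ p) k w with k' ℤ.≟ k | w' ≟ w
... | yes _ | yes _ = q ℚ.+ coeff _≟_ p k w
... | _     | _     = coeff _≟_ p k w

data AB : Set where
  𝐚 𝐛 : AB

_≟AB_ : DecidableEquality AB
𝐚 ≟AB 𝐚 = yes refl
𝐚 ≟AB 𝐛 = no (λ ())
𝐛 ≟AB 𝐚 = no (λ ())
𝐛 ≟AB 𝐛 = yes refl

Word : Set
Word = List AB

𝔥 : Set
𝔥 = Lin Word

_≈_ : 𝔥 → 𝔥 → Set
p ≈ r = ∀ (k : ℤ) (w : Word) → coeff (≡-dec _≟AB_) p k w ≡ coeff (≡-dec _≟AB_) r k w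

pre : {A : Set} → A → Lin (List A) → Lin (List A)
pre x = map (λ { (q , k , w) → (q , k , x ∷ w) })

_·_ : 𝔥 → 𝔥 → 𝔥
_·_ = bilin (λ u v → single (u ++ v))

shw : Word → Word → 𝔥
shw [] w' = single w'
shw (𝐛 ∷ w) w' = pre 𝐛 (shw w w')
shw (𝐚 ∷ w) [] = single (𝐚 ∷ w)
shw (𝐚 ∷ w) (𝐛 ∷ w') = pre 𝐛 (shw (𝐚 ∷ w) w')
shw (𝐚 ∷ w) (𝐚 ∷ w') =
  pre 𝐚 (shw (𝐚 ∷ w) w' ⊕ (shw w (𝐚 ∷ w') ⊕ scale 1ℚ (+ 1) (shw w w')))

_ш_ : 𝔥 → 𝔥 → 𝔥
_ш_ = bilin shw

-- Index set ℕ̂ = {1̄} ⊔ ℕ (ℕ = {1,2,3,...}).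
-- Convention: `pos n` stands for the index n+1 ∈ ℕ, so e_(pos n) = e_{n+1}.

data ℕ̂ : Set where
  1̄   : ℕ̂
  pos : ℕ → ℕ̂

pos-inj : ∀ {m n} → pos m ≡ pos n → m ≡ n
pos-inj refl = refl

_≟ℕ̂_ : DecidableEquality ℕ̂
1̄ ≟ℕ̂ 1̄ = yes refl
1̄ ≟ℕ̂ pos _ = no (λ ())
pos _ ≟ℕ̂ 1̄ = no (λ ())
pos m ≟ℕ̂ pos n with m Data.Nat.≟ n
... | yes refl = yes refl
... | no ne = no (λ e → ne (pos-inj e))

-- The free C-algebra on {e_k}_{k ∈ ℕ̂}: basis = words in ℕ̂.
-- It is identified with the subalgebra \widehat{𝔥^1} ⊂ 𝔥 via `emb` below.
H1 : Set
H1 = Lin (List ℕ̂)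

circ : ℕ̂ → ℕ̂ → Lin ℕ̂
circ 1̄ 1̄ = single (pos 1) ⊕ scale (ℚ.- 1ℚ) (+ 1) (single 1̄)
circ 1̄ (pos n) = single (pos (suc n))
circ (pos m) 1̄ = single (pos (suc m))
circ (pos m) (pos n) = single (pos (suc (m + n))) ⊕ scale 1ℚ (+ 1) (single (pos (m + n)))

stw : List ℕ̂ → List ℕ̂ → H1
stw [] w' = single w'
stw (x ∷ w) [] = single (x ∷ w)
stw (x ∷ w) (y ∷ w') =
  pre x (stw w (y ∷ w')) ⊕ (pre y (stw (x ∷ w) w')
    ⊕ bilin (λ z u → single (z ∷ u)) (circ x y) (stw w w'))

_✱_ : H1 → H1 → H1
_✱_ = bilin stw

embLetter : ℕ̂ → 𝔥
embLetter 1̄ = single (𝐚 ∷ 𝐛 ∷ [])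
embLetter (pos n) =
  single (replicate (suc n) 𝐚 ++ 𝐛 ∷ []) ⊕ scale 1ℚ (+ 1) (single (replicate n 𝐚 ++ 𝐛 ∷ []))

embWord : List ℕ̂ → 𝔥
embWord [] = single []
embWord (x ∷ w) = embLetter x · embWord w

emb : H1 → 𝔥
emb = linExt embWord

Ser : Set → Set
Ser W = ℕ → Lin W

conv : {W : Set} → (Lin W → Lin W → Lin W) → Ser W → Ser W → Ser W
conv _⋆_ f g N = concatMap (λ i → f i ⋆ g (N ∸ i)) (upTo (suc N))

unitSer : {A : Set} → Ser (List A)
unitSer zero = single []
unitSer (suc _) = zeroL

power : {A : Set} → (Lin (List A) → Lin (List A) → Lin (List A)) → Ser (List A) → ℕ → Ser (List A)
power _⋆_ f zero = unitSer
power _⋆_ f (suc n) = conv _⋆_ f (power _⋆_ f n)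

logCoef : ℕ → ℚ
logCoef n = ((ℤ.- (+ 1)) ℤ.^ n) ℚ./ suc n

-- Since f has no constant term, f^{⋆n} has X-order ≥ n, so the coefficient of
-- X^N of the infinite sum is the finite sum over 1 ≤ n ≤ N.
logSer : {A : Set} → (Lin (List A) → Lin (List A) → Lin (List A)) → Ser (List A) → Ser (List A)
logSer _⋆_ f N = concatMap (λ n → scale (logCoef n) (+ 0) (power _⋆_ f (suc n) N)) (upTo N)

-- f = 1/(1 - e_1̄ X) - 1 = Σ_{n≥1} e_1̄^n X^n  (in \widehat{𝔥^1})
geomMinus1 : Ser (List ℕ̂)
geomMinus1 zero = zeroL
geomMinus1 (suc n) = single (replicate (suc n) 1̄)

geomMinus1𝔥 : Ser Word
geomMinus1𝔥 N = emb (geomMinus1 N)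

ψ : Ser Word
ψ zero = zeroL
ψ (suc n) = (logCoef n , + n , 𝐚 ∷ replicate (suc n) 𝐛) ∷ []

φ : Ser Word
φ zero = zeroL
φ (suc n) = (logCoef n , + 0 , replicate (suc n) 𝐚 ++ 𝐛 ∷ []) ∷ []

-- Write 1/(1 - e₁̄X) = 1 + f and θ = X d/dX.  In a commutative algebra of series,
-- log(1 + f) is the only series L without constant term with (1 + f) θL = θf.
-- Both products are quasi-shuffle products: the stuffle on the letters e_k, and
-- the shuffle restricted to the words a bⁿ, where merging a bᵐ with a bⁿ gives
-- ħ a b^{m+n}.  In a quasi-shuffle algebra, the product e₁̄^i ⋆ zⱼ, with zⱼ the
-- one-letter word e₁̄ ∘ ⋯ ∘ e₁̄ (j + 1 factors), consists of the insertions of zⱼ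
-- into e₁̄^i and of zⱼ₊₁ into e₁̄^{i-1}; these telescope against alternating signs,
-- so Σ (-1)^{n-1}/n z_{n-1} Xⁿ solves the equation.  Finally z_{n-1} is aⁿ b in the
-- stuffle case and ħ^{n-1} a bⁿ in the shuffle case.

module Submission where

open import Defs
open import Data.Nat as ℕ using (ℕ; zero; suc; _+_; _∸_; _≤_; _<_; s≤s)
import Data.Nat.Properties as ℕP
open import Data.Integer as ℤ using (ℤ; +_)
import Data.Integer.Properties as ℤP
import Data.Integer.Tactic.RingSolver as ℤ-Solver
open import Data.Rational as ℚ using (ℚ; 0ℚ; 1ℚ)
import Data.Rational.Properties as ℚP
import Data.Rational.Unnormalised as ℚᵘ
import Data.Rational.Unnormalised.Properties as ℚᵘP
open import Data.List using (List; []; _∷_; _++_; map; concatMap; upTo; applyUpTo; replicate)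
import Data.List.Properties as ListP
open import Data.Product using (_×_; _,_)
open import Data.Sum using (_⊎_; inj₁; inj₂)
open import Relation.Nullary using (yes; no)
open import Relation.Nullary.Decidable using (dec⇒maybe)
open import Relation.Binary.Definitions using (DecidableEquality)
open import Relation.Binary.Bundles using (Setoid)
import Relation.Binary.Reasoning.Setoid as SetoidReasoning
open import Relation.Binary.PropositionalEquality
open import Tactic.RingSolver using (solve-∀)
open import Algebra.Properties.Group ℚP.+-0-group using (∙-cancelʳ)
open import Tactic.RingSolver.Core.AlmostCommutativeRing using (AlmostCommutativeRing; fromCommutativeRing)

-1ℚ : ℚ
-1ℚ = ℚ.- 1ℚ

ℚ-ring : AlmostCommutativeRing _ _
ℚ-ring = fromCommutativeRing ℚP.+-*-commutativeRing (λ x → dec⇒maybe (0ℚ ℚP.≟ x))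

-- Linear combinations up to equality of coefficients

-- A combination is tested against every "functional" g : ℤ → W → ℚ, read as
-- the value of g on ħ^k w.  Equality of all such pairings is equality of all
-- coefficients (≋⇒≈ below), and it makes linearity arguments purely equational.

module _ {W : Set} where

  ∫ : (ℤ → W → ℚ) → Lin W → ℚ
  ∫ g [] = 0ℚ
  ∫ g ((q , k , w) ∷ p) = q ℚ.* g k w ℚ.+ ∫ g p

  shift : ℤ → (ℤ → W → ℚ) → ℤ → W → ℚ
  shift k g k' w = g (k ℤ.+ k') w

  ∫-cong : ∀ {g h : ℤ → W → ℚ} → (∀ k w → g k w ≡ h k w) → ∀ p → ∫ g p ≡ ∫ h p
  ∫-cong e [] = refl
  ∫-cong e ((q , k , w) ∷ p) = cong₂ (λ a b → q ℚ.* a ℚ.+ b) (e k w) (∫-cong e p)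

  ∫-++ : ∀ g (p r : Lin W) → ∫ g (p ++ r) ≡ ∫ g p ℚ.+ ∫ g r
  ∫-++ g [] r = sym (ℚP.+-identityˡ _)
  ∫-++ g ((q , k , w) ∷ p) r =
    trans (cong (q ℚ.* g k w ℚ.+_) (∫-++ g p r)) (sym (ℚP.+-assoc (q ℚ.* g k w) (∫ g p) (∫ g r)))

  ∫-+ : ∀ (g h : ℤ → W → ℚ) p → ∫ (λ k w → g k w ℚ.+ h k w) p ≡ ∫ g p ℚ.+ ∫ h p
  ∫-+ g h [] = sym (ℚP.+-identityˡ _)
  ∫-+ g h ((q , k , w) ∷ p) =
    trans (cong (q ℚ.* (g k w ℚ.+ h k w) ℚ.+_) (∫-+ g h p)) (regroup q (g k w) (h k w) (∫ g p) (∫ h p))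
    where
    regroup : ∀ q a b c d → q ℚ.* (a ℚ.+ b) ℚ.+ (c ℚ.+ d) ≡ (q ℚ.* a ℚ.+ c) ℚ.+ (q ℚ.* b ℚ.+ d)
    regroup = solve-∀ ℚ-ring

  ∫-* : ∀ a (g : ℤ → W → ℚ) p → ∫ (λ k w → a ℚ.* g k w) p ≡ a ℚ.* ∫ g p
  ∫-* a g [] = sym (ℚP.*-zeroʳ a)
  ∫-* a g ((q , k , w) ∷ p) =
    trans (cong (q ℚ.* (a ℚ.* g k w) ℚ.+_) (∫-* a g p)) (regroup q a (g k w) (∫ g p))
    where
    regroup : ∀ q a x y → q ℚ.* (a ℚ.* x) ℚ.+ a ℚ.* y ≡ a ℚ.* (q ℚ.* x ℚ.+ y)
    regroup = solve-∀ ℚ-ring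

  ∫-zero : ∀ (p : Lin W) → ∫ (λ _ _ → 0ℚ) p ≡ 0ℚ
  ∫-zero [] = refl
  ∫-zero ((q , k , w) ∷ p) =
    trans (cong (q ℚ.* 0ℚ ℚ.+_) (∫-zero p)) (trans (ℚP.+-identityʳ _) (ℚP.*-zeroʳ q))

  ∫-scale : ∀ g a k (p : Lin W) → ∫ g (scale a k p) ≡ a ℚ.* ∫ (shift k g) p
  ∫-scale g a k [] = sym (ℚP.*-zeroʳ a)
  ∫-scale g a k ((q , k' , w) ∷ p) =
    trans (cong ((a ℚ.* q) ℚ.* g (k ℤ.+ k') w ℚ.+_) (∫-scale g a k p)) (regroup a q _ _)
    where
    regroup : ∀ a q x y → (a ℚ.* q) ℚ.* x ℚ.+ a ℚ.* y ≡ a ℚ.* (q ℚ.* x ℚ.+ y)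
    regroup = solve-∀ ℚ-ring

  ∫-single : ∀ g w → ∫ g (single w) ≡ g (+ 0) w
  ∫-single g w = trans (ℚP.+-identityʳ _) (ℚP.*-identityˡ _)

  ∫-shift-0 : ∀ (g : ℤ → W → ℚ) p → ∫ (shift (+ 0) g) p ≡ ∫ g p
  ∫-shift-0 g = ∫-cong (λ k w → cong (λ t → g t w) (ℤP.+-identityˡ k))

  ∫-shift-shift : ∀ (g : ℤ → W → ℚ) k k' p → ∫ (shift k (shift k' g)) p ≡ ∫ (shift (k' ℤ.+ k) g) p
  ∫-shift-shift g k k' = ∫-cong (λ K w → cong (λ t → g t w) (sym (ℤP.+-assoc k' k K)))

  ∫-shift-comm : ∀ (g : ℤ → W → ℚ) k k' p → ∫ (shift k (shift k' g)) p ≡ ∫ (shift k' (shift k g)) p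
  ∫-shift-comm g k k' = ∫-cong (λ K w → cong (λ t → g t w) (swap k k' K))
    where
    swap : ∀ a b c → b ℤ.+ (a ℤ.+ c) ≡ a ℤ.+ (b ℤ.+ c)
    swap = ℤ-Solver.solve-∀

∫-pre : ∀ {A : Set} (x : A) g (p : Lin (List A)) → ∫ g (pre x p) ≡ ∫ (λ k w → g k (x ∷ w)) p
∫-pre x g [] = refl
∫-pre x g ((q , k , w) ∷ p) = cong (q ℚ.* g k (x ∷ w) ℚ.+_) (∫-pre x g p)

mapW : {V W : Set} → (V → W) → Lin V → Lin W
mapW h = map (λ { (q , k , w) → (q , k , h w) })

module _ {V W : Set} where

  ∫-mapW : ∀ (h : V → W) g p → ∫ g (mapW h p) ≡ ∫ (λ k w → g k (h w)) p
  ∫-mapW h g [] = refl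
  ∫-mapW h g ((q , k , w) ∷ p) = cong (q ℚ.* g k (h w) ℚ.+_) (∫-mapW h g p)

  ∫-linExt : ∀ g (f : V → Lin W) p → ∫ g (linExt f p) ≡ ∫ (λ k w → ∫ (shift k g) (f w)) p
  ∫-linExt g f [] = refl
  ∫-linExt g f ((q , k , w) ∷ p) =
    trans (∫-++ g (scale q k (f w)) (linExt f p)) (cong₂ ℚ._+_ (∫-scale g q k (f w)) (∫-linExt g f p))

  ∫-∫-comm : ∀ (G : ℤ → V → ℤ → W → ℚ) p r →
    ∫ (λ k v → ∫ (G k v) r) p ≡ ∫ (λ k' w → ∫ (λ k v → G k v k' w) p) r
  ∫-∫-comm G [] r = sym (∫-zero r)
  ∫-∫-comm G ((q , k , v) ∷ p) r =
    trans (cong₂ ℚ._+_ (sym (∫-* q (G k v) r)) (∫-∫-comm G p r))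
      (sym (∫-+ (λ k' w → q ℚ.* G k v k' w) (λ k' w → ∫ (λ k v → G k v k' w) p) r))

module _ {W : Set} where

  infix 4 _≋_
  record _≋_ (p r : Lin W) : Set where
    constructor mk≋
    field ∫-≡ : ∀ g → ∫ g p ≡ ∫ g r
  open _≋_ public

  ≋-refl : ∀ {p} → p ≋ p
  ≋-refl = mk≋ λ g → refl

  ≋-sym : ∀ {p r} → p ≋ r → r ≋ p
  ≋-sym e = mk≋ λ g → sym (∫-≡ e g)

  ≋-trans : ∀ {p r s} → p ≋ r → r ≋ s → p ≋ s
  ≋-trans e e' = mk≋ λ g → trans (∫-≡ e g) (∫-≡ e' g)

  ≋-setoid : Setoid _ _
  ≋-setoid = record
    { Carrier = Lin W
    ; _≈_ = _≋_
    ; isEquivalence = record { refl = ≋-refl ; sym = ≋-sym ; trans = ≋-trans }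
    }

  ≡⇒≋ : ∀ {p r} → p ≡ r → p ≋ r
  ≡⇒≋ refl = ≋-refl

  ⊕-cong : ∀ {p p' r r'} → p ≋ p' → r ≋ r' → (p ⊕ r) ≋ (p' ⊕ r')
  ⊕-cong {p} {p'} {r} {r'} e e' = mk≋ λ g →
    trans (∫-++ g p r) (trans (cong₂ ℚ._+_ (∫-≡ e g) (∫-≡ e' g)) (sym (∫-++ g p' r')))

  ⊕-congˡ : ∀ (r : Lin W) {p p'} → p ≋ p' → (p ⊕ r) ≋ (p' ⊕ r)
  ⊕-congˡ r e = ⊕-cong e ≋-refl

  ⊕-congʳ : ∀ (p : Lin W) {r r'} → r ≋ r' → (p ⊕ r) ≋ (p ⊕ r')
  ⊕-congʳ p e = ⊕-cong ≋-refl e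

  ⊕-comm : ∀ p r → (p ⊕ r) ≋ (r ⊕ p)
  ⊕-comm p r = mk≋ λ g →
    trans (∫-++ g p r) (trans (ℚP.+-comm (∫ g p) (∫ g r)) (sym (∫-++ g r p)))

  ⊕-assoc : ∀ p r s → ((p ⊕ r) ⊕ s) ≋ (p ⊕ (r ⊕ s))
  ⊕-assoc p r s = ≡⇒≋ (ListP.++-assoc p r s)

  ⊕-identityʳ : ∀ p → (p ⊕ zeroL) ≋ p
  ⊕-identityʳ p = ≡⇒≋ (ListP.++-identityʳ p)

  ⊕-zeroˡ : ∀ {p r} → p ≋ zeroL → (p ⊕ r) ≋ r
  ⊕-zeroˡ {p} {r} e = ⊕-congˡ r e

  ⊕-zeroʳ : ∀ {p r} → r ≋ zeroL → (p ⊕ r) ≋ p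
  ⊕-zeroʳ {p} {r} e = ≋-trans (⊕-congʳ p e) (⊕-identityʳ p)

  ⊕-cancelʳ : ∀ {p r s} → (p ⊕ s) ≋ (r ⊕ s) → p ≋ r
  ⊕-cancelʳ {p} {r} {s} e = mk≋ λ g →
    ∙-cancelʳ (∫ g s) (∫ g p) (∫ g r) (trans (sym (∫-++ g p s)) (trans (∫-≡ e g) (∫-++ g r s)))

  ⊕-swap : ∀ a b c → (a ⊕ (b ⊕ c)) ≋ (b ⊕ (a ⊕ c))
  ⊕-swap a b c = ≋-trans (≋-sym (⊕-assoc a b c)) (≋-trans (⊕-congˡ c (⊕-comm a b)) (⊕-assoc b a c))

  ⊕-interchange : ∀ a b c d → ((a ⊕ b) ⊕ (c ⊕ d)) ≋ ((a ⊕ c) ⊕ (b ⊕ d))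
  ⊕-interchange a b c d = ≋-trans (⊕-assoc a b (c ⊕ d)) (≋-trans (⊕-congʳ a (⊕-swap b c d))
    (≋-sym (⊕-assoc a c (b ⊕ d))))

  scale-cong : ∀ a k {p r} → p ≋ r → scale a k p ≋ scale a k r
  scale-cong a k {p} {r} e = mk≋ λ g →
    trans (∫-scale g a k p) (trans (cong (a ℚ.*_) (∫-≡ e (shift k g))) (sym (∫-scale g a k r)))

  module ≋-Reasoning = SetoidReasoning ≋-setoid

coeff-∫ : ∀ {W} (_≟_ : DecidableEquality W) p K V →
  coeff _≟_ p K V ≡ ∫ (λ k w → coeff _≟_ ((1ℚ , k , w) ∷ []) K V) p
coeff-∫ _≟_ [] K V = refl
coeff-∫ _≟_ ((q , k , w) ∷ p) K V with k ℤ.≟ K | w ≟ V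
... | yes _ | yes _ =
  cong₂ ℚ._+_ (sym (trans (cong (q ℚ.*_) (ℚP.+-identityʳ 1ℚ)) (ℚP.*-identityʳ q))) (coeff-∫ _≟_ p K V)
... | yes _ | no _ = trans (coeff-∫ _≟_ p K V) (sym (trans (cong (ℚ._+ _) (ℚP.*-zeroʳ q)) (ℚP.+-identityˡ _)))
... | no _ | _ = trans (coeff-∫ _≟_ p K V) (sym (trans (cong (ℚ._+ _) (ℚP.*-zeroʳ q)) (ℚP.+-identityˡ _)))

≋⇒≈ : ∀ {p r : 𝔥} → p ≋ r → p ≈ r
≋⇒≈ {p} {r} e K V = trans (coeff-∫ dec p K V) (trans (∫-≡ e _) (sym (coeff-∫ dec r K V)))
  where dec = ListP.≡-dec _≟AB_

-- C-linearity: pairing with F p only depends on the values of F on basis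
-- elements, each contributing with the power of ħ it is multiplied by.
module _ {V W : Set} where

  record IsLinear (F : Lin V → Lin W) : Set where
    constructor mkLinear
    field ∫-linear : ∀ g p → ∫ g (F p) ≡ ∫ (λ k v → ∫ (shift k g) (F (single v))) p
  open IsLinear public

  linear-ext : ∀ {F G : Lin V → Lin W} → IsLinear F → IsLinear G →
    (∀ v → F (single v) ≋ G (single v)) → ∀ p → F p ≋ G p
  linear-ext F-lin G-lin e p = mk≋ λ g →
    trans (∫-linear F-lin g p) (trans (∫-cong (λ k v → ∫-≡ (e v) (shift k g)) p) (sym (∫-linear G-lin g p)))

  linear-cong : ∀ {F : Lin V → Lin W} → IsLinear F → ∀ {p r} → p ≋ r → F p ≋ F r
  linear-cong F-lin {p} {r} e = mk≋ λ g →
    trans (∫-linear F-lin g p) (trans (∫-≡ e _) (sym (∫-linear F-lin g r)))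

  linear-zero : ∀ {F : Lin V → Lin W} → IsLinear F → F zeroL ≋ zeroL
  linear-zero F-lin = mk≋ λ g → ∫-linear F-lin g []

  linear-⊕ : ∀ {F : Lin V → Lin W} → IsLinear F → ∀ p r → F (p ⊕ r) ≋ (F p ⊕ F r)
  linear-⊕ {F} F-lin p r = mk≋ λ g → trans (∫-linear F-lin g (p ⊕ r)) (trans (∫-++ _ p r)
    (trans (cong₂ ℚ._+_ (sym (∫-linear F-lin g p)) (sym (∫-linear F-lin g r))) (sym (∫-++ g (F p) (F r)))))

  linear-scale : ∀ {F : Lin V → Lin W} → IsLinear F → ∀ a k p → F (scale a k p) ≋ scale a k (F p)
  linear-scale {F} F-lin a k p = mk≋ λ g → trans (∫-linear F-lin g (scale a k p)) (trans (∫-scale _ a k p)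
    (trans (cong (a ℚ.*_) (∫-cong (λ k' v → sym (∫-shift-shift g k' k (F (single v)))) p))
    (trans (cong (a ℚ.*_) (sym (∫-linear F-lin (shift k g) p))) (sym (∫-scale g a k (F p))))))

  linExt-single : ∀ (f : V → Lin W) v → linExt f (single v) ≋ f v
  linExt-single f v = mk≋ λ g → trans (∫-linExt g f (single v))
    (trans (∫-single (λ k w → ∫ (shift k g) (f w)) v) (∫-shift-0 g (f v)))

  linExt-linear : ∀ (f : V → Lin W) → IsLinear (linExt f)
  linExt-linear f = mkLinear λ g p →
    trans (∫-linExt g f p) (∫-cong (λ k v → sym (∫-≡ (linExt-single f v) (shift k g))) p)

  ⊕-linear : ∀ {F G : Lin V → Lin W} → IsLinear F → IsLinear G → IsLinear (λ p → F p ⊕ G p)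
  ⊕-linear {F} {G} F-lin G-lin = mkLinear λ g p →
    trans (∫-++ g (F p) (G p)) (trans (cong₂ ℚ._+_ (∫-linear F-lin g p) (∫-linear G-lin g p))
      (trans (sym (∫-+ _ _ p)) (∫-cong (λ k v → sym (∫-++ (shift k g) (F (single v)) (G (single v)))) p)))

  mapW-linear : ∀ (h : V → W) → IsLinear (mapW h)
  mapW-linear h = mkLinear λ g p → trans (∫-mapW h g p) (∫-cong (λ k v → sym
    (trans (∫-mapW h (shift k g) (single v))
      (trans (∫-single (λ k' w → shift k g k' (h w)) v) (cong (λ t → g t (h v)) (ℤP.+-identityʳ k))))) p)

module _ {W : Set} where

  id-linear : IsLinear {W} {W} (λ p → p)
  id-linear = mkLinear λ g p → ∫-cong (λ k w → sym
    (trans (∫-single (shift k g) w) (cong (λ t → g t w) (ℤP.+-identityʳ k)))) p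

  scale-linear : ∀ a k → IsLinear {W} {W} (scale a k)
  scale-linear a k = mkLinear λ g p → trans (∫-scale g a k p) (trans (cong (a ℚ.*_) (∫-linear id-linear (shift k g) p))
    (trans (sym (∫-* a _ p)) (∫-cong (λ k' w → trans (cong (a ℚ.*_) (∫-shift-comm g k' k (single w)))
      (sym (∫-scale (shift k' g) a k (single w)))) p)))

pre-linear : ∀ {A : Set} (x : A) → IsLinear (pre x)
pre-linear x = mkLinear λ g p → trans (∫-pre x g p) (∫-cong (λ k u → sym (trans (∫-pre x (shift k g) (single u))
  (trans (∫-single (λ k' w → shift k g k' (x ∷ w)) u) (cong (λ t → g t (x ∷ u)) (ℤP.+-identityʳ k))))) p)

∘-linear : ∀ {U V W : Set} {F : Lin V → Lin W} {G : Lin U → Lin V} →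
  IsLinear F → IsLinear G → IsLinear (λ p → F (G p))
∘-linear {F = F} {G} F-lin G-lin = mkLinear λ g p →
  trans (∫-linear F-lin g (G p)) (trans (∫-linear G-lin _ p) (∫-cong (λ k' u →
    trans (∫-cong (λ k v → sym (∫-shift-shift g k k' (F (single v)))) (G (single u)))
      (sym (∫-linear F-lin (shift k' g) (G (single u))))) p))

module _ {U V W : Set} (F : U → V → Lin W) where

  ∫-bilin : ∀ g p r → ∫ g (bilin F p r) ≡ ∫ (λ k u → ∫ (λ k' v → ∫ (shift k' (shift k g)) (F u v)) r) p
  ∫-bilin g p r = trans (∫-linExt g _ p) (∫-cong (λ k u → ∫-linExt (shift k g) (F u) r) p)

  bilin-linearˡ : ∀ r → IsLinear (λ p → bilin F p r)
  bilin-linearˡ r = linExt-linear _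

  bilin-linearʳ : ∀ p → IsLinear (λ r → bilin F p r)
  bilin-linearʳ p = mkLinear λ g r → trans (∫-bilin g p r) (trans (∫-∫-comm _ p r)
    (∫-cong (λ k' v → sym (trans (∫-bilin (shift k' g) p (single v))
      (∫-cong (λ k u → trans (∫-single (λ k'' v' → ∫ (shift k'' (shift k (shift k' g))) (F u v')) v)
        (trans (∫-shift-0 (shift k (shift k' g)) (F u v)) (∫-shift-comm g k k' (F u v)))) p))) r))

  bilin-cong : ∀ {p p' r r'} → p ≋ p' → r ≋ r' → bilin F p r ≋ bilin F p' r'
  bilin-cong {p' = p'} {r = r} e e' =
    ≋-trans (linear-cong (bilin-linearˡ r) e) (linear-cong (bilin-linearʳ p') e')

  bilin-single : ∀ u v → bilin F (single u) (single v) ≋ F u v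
  bilin-single u v = ≋-trans (linExt-single (λ u → linExt (F u) (single v)) u) (linExt-single (F u) v)

module _ {W : Set} where

  infixr 25 _•_
  _•_ : ℚ → Lin W → Lin W
  a • p = scale a (+ 0) p

  ∫-• : ∀ g a (p : Lin W) → ∫ g (a • p) ≡ a ℚ.* ∫ g p
  ∫-• g a p = trans (∫-scale g a (+ 0) p) (cong (a ℚ.*_) (∫-shift-0 g p))

  •-cong : ∀ a {p r : Lin W} → p ≋ r → a • p ≋ a • r
  •-cong a = scale-cong a (+ 0)

  •-≡ : ∀ {a b : ℚ} (p : Lin W) → a ≡ b → a • p ≋ b • p
  •-≡ p refl = ≋-refl

  •-distribˡ-⊕ : ∀ a (p r : Lin W) → a • (p ⊕ r) ≋ (a • p ⊕ a • r)
  •-distribˡ-⊕ a p r = ≡⇒≋ (ListP.map-++ _ p r)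

  •-distribʳ-+ : ∀ a b (p : Lin W) → (a ℚ.+ b) • p ≋ (a • p ⊕ b • p)
  •-distribʳ-+ a b p = mk≋ λ g → trans (∫-• g (a ℚ.+ b) p) (trans (ℚP.*-distribʳ-+ (∫ g p) a b)
    (sym (trans (∫-++ g (a • p) (b • p)) (cong₂ ℚ._+_ (∫-• g a p) (∫-• g b p)))))

  •-assoc : ∀ a b (p : Lin W) → a • b • p ≋ (a ℚ.* b) • p
  •-assoc a b p = mk≋ λ g → trans (∫-• g a (b • p)) (trans (cong (a ℚ.*_) (∫-• g b p))
    (trans (sym (ℚP.*-assoc a b (∫ g p))) (sym (∫-• g (a ℚ.* b) p))))

  •-comm : ∀ a b (p : Lin W) → a • b • p ≋ b • a • p
  •-comm a b p = ≋-trans (•-assoc a b p) (≋-trans (•-≡ p (ℚP.*-comm a b)) (≋-sym (•-assoc b a p)))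

  •-identityˡ : ∀ (p : Lin W) → 1ℚ • p ≋ p
  •-identityˡ p = mk≋ λ g → trans (∫-• g 1ℚ p) (ℚP.*-identityˡ _)

  •-zeroˡ : ∀ (p : Lin W) → 0ℚ • p ≋ zeroL
  •-zeroˡ p = mk≋ λ g → trans (∫-• g 0ℚ p) (ℚP.*-zeroˡ (∫ g p))

  •-cancelˡ : ∀ a b {p r : Lin W} → b ℚ.* a ≡ 1ℚ → a • p ≋ a • r → p ≋ r
  •-cancelˡ a b {p} {r} ba≡1 e = mk≋ λ g → trans (sym (b*[a*x]≡x (∫ g p))) (trans (cong (b ℚ.*_)
    (trans (sym (∫-• g a p)) (trans (∫-≡ e g) (∫-• g a r)))) (b*[a*x]≡x (∫ g r)))
    where
    b*[a*x]≡x : ∀ x → b ℚ.* (a ℚ.* x) ≡ x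
    b*[a*x]≡x x = trans (sym (ℚP.*-assoc b a x)) (trans (cong (ℚ._* x) ba≡1) (ℚP.*-identityˡ x))

  ⊕-inverseʳ : ∀ (p : Lin W) → (p ⊕ -1ℚ • p) ≋ zeroL
  ⊕-inverseʳ p = mk≋ λ g → trans (∫-++ g p (-1ℚ • p))
    (trans (cong (∫ g p ℚ.+_) (∫-• g -1ℚ p)) (x-x≡0 (∫ g p)))
    where
    x-x≡0 : ∀ x → x ℚ.+ -1ℚ ℚ.* x ≡ 0ℚ
    x-x≡0 = solve-∀ ℚ-ring

linear-• : ∀ {V W : Set} {F : Lin V → Lin W} → IsLinear F → ∀ a p → F (a • p) ≋ a • F p
linear-• F-lin a = linear-scale F-lin a (+ 0)

toℚ : ℕ → ℚ
toℚ n = + n ℚ./ 1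

toℚ-+ : ∀ m n → toℚ (m + n) ≡ toℚ m ℚ.+ toℚ n
toℚ-+ m n = ℚP.toℚᵘ-injective (ℚᵘP.≃-trans (ℚP.toℚᵘ-fromℚᵘ (ℚᵘ.mkℚᵘ (+ (m + n)) 0))
  (ℚᵘP.≃-trans (ℚᵘ.*≡* cross) (ℚᵘP.≃-sym (ℚᵘP.≃-trans (ℚP.toℚᵘ-homo-+ (toℚ m) (toℚ n))
    (ℚᵘP.+-cong (ℚP.toℚᵘ-fromℚᵘ (ℚᵘ.mkℚᵘ (+ m) 0)) (ℚP.toℚᵘ-fromℚᵘ (ℚᵘ.mkℚᵘ (+ n) 0)))))))
  where
  cross : + (m + n) ℤ.* + 1 ≡ (+ m ℤ.* + 1 ℤ.+ + n ℤ.* + 1) ℤ.* + 1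
  cross rewrite ℤP.*-identityʳ (+ (m + n)) | ℤP.*-identityʳ (+ m) | ℤP.*-identityʳ (+ n)
              | ℤP.*-identityʳ (+ m ℤ.+ + n) = refl

toℚ[1+n]*[z/1+n]≡z : ∀ (z : ℤ) n → toℚ (suc n) ℚ.* (z ℚ./ suc n) ≡ z ℚ./ 1
toℚ[1+n]*[z/1+n]≡z z n = ℚP.toℚᵘ-injective (ℚᵘP.≃-trans (ℚP.toℚᵘ-homo-* (toℚ (suc n)) (z ℚ./ suc n))
  (ℚᵘP.≃-trans (ℚᵘP.*-cong (ℚP.toℚᵘ-fromℚᵘ (ℚᵘ.mkℚᵘ (+ suc n) 0)) (ℚP.toℚᵘ-fromℚᵘ (ℚᵘ.mkℚᵘ z n)))
  (ℚᵘP.≃-trans (ℚᵘ.*≡* cross) (ℚᵘP.≃-sym (ℚP.toℚᵘ-fromℚᵘ (ℚᵘ.mkℚᵘ z 0))))))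
  where
  cross : (+ suc n ℤ.* z) ℤ.* + 1 ≡ z ℤ.* (+ suc (n + 0 ℕ.* suc n))
  cross rewrite ℕP.+-identityʳ n = trans (ℤP.*-identityʳ _) (ℤP.*-comm (+ suc n) z)

sign : ℕ → ℚ
sign n = ((ℤ.- (+ 1)) ℤ.^ n) ℚ./ 1

-1^n≡±1 : ∀ n → ((ℤ.- (+ 1)) ℤ.^ n ≡ + 1) ⊎ ((ℤ.- (+ 1)) ℤ.^ n ≡ ℤ.- (+ 1))
-1^n≡±1 zero = inj₁ refl
-1^n≡±1 (suc n) with -1^n≡±1 n
... | inj₁ e = inj₂ (cong ((ℤ.- (+ 1)) ℤ.*_) e)
... | inj₂ e = inj₁ (cong ((ℤ.- (+ 1)) ℤ.*_) e)

sign-suc : ∀ n → sign (suc n) ≡ ℚ.- sign n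
sign-suc n with -1^n≡±1 n
... | inj₁ e rewrite e = refl
... | inj₂ e rewrite e = refl

1/[1+n]*toℚ[1+n]≡1 : ∀ n → (+ 1 ℚ./ suc n) ℚ.* toℚ (suc n) ≡ 1ℚ
1/[1+n]*toℚ[1+n]≡1 n = trans (ℚP.*-comm (+ 1 ℚ./ suc n) (toℚ (suc n))) (toℚ[1+n]*[z/1+n]≡z (+ 1) n)

toℚ*logCoef : ∀ n → toℚ (suc n) ℚ.* logCoef n ≡ sign n
toℚ*logCoef n = toℚ[1+n]*[z/1+n]≡z ((ℤ.- (+ 1)) ℤ.^ n) n

-- Finite sums

module _ {W : Set} where

  antidiag : (ℕ → ℕ → Lin W) → ℕ → Lin W
  antidiag F zero = F 0 0
  antidiag F (suc N) = F 0 (suc N) ⊕ antidiag (λ i j → F (suc i) j) N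

  sumBelow : (ℕ → Lin W) → ℕ → Lin W
  sumBelow G zero = zeroL
  sumBelow G (suc N) = G 0 ⊕ sumBelow (λ n → G (suc n)) N

  concatMap-applyUpTo : ∀ (G : ℕ → Lin W) h n →
    concatMap G (applyUpTo h n) ≡ concatMap (λ i → G (h i)) (upTo n)
  concatMap-applyUpTo G h zero = refl
  concatMap-applyUpTo G h (suc n) = cong (G (h 0) ++_)
    (trans (concatMap-applyUpTo G (λ i → h (suc i)) n) (sym (concatMap-applyUpTo (λ i → G (h i)) suc n)))

  concatMap-upTo-∸≋antidiag : ∀ (F : ℕ → ℕ → Lin W) N →
    concatMap (λ i → F i (N ∸ i)) (upTo (suc N)) ≋ antidiag F N
  concatMap-upTo-∸≋antidiag F zero = ⊕-identityʳ (F 0 0)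
  concatMap-upTo-∸≋antidiag F (suc N) = ⊕-congʳ (F 0 (suc N)) (≋-trans
    (≡⇒≋ (concatMap-applyUpTo (λ i → F i (suc N ∸ i)) suc (suc N)))
    (concatMap-upTo-∸≋antidiag (λ i j → F (suc i) j) N))

  concatMap-upTo≡sumBelow : ∀ (G : ℕ → Lin W) N → concatMap G (upTo N) ≡ sumBelow G N
  concatMap-upTo≡sumBelow G zero = refl
  concatMap-upTo≡sumBelow G (suc N) = cong (G 0 ++_)
    (trans (concatMap-applyUpTo G suc N) (concatMap-upTo≡sumBelow (λ n → G (suc n)) N))

  antidiag-cong : ∀ N {F G : ℕ → ℕ → Lin W} → (∀ i j → i + j ≡ N → F i j ≋ G i j) →
    antidiag F N ≋ antidiag G N
  antidiag-cong zero e = e 0 0 refl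
  antidiag-cong (suc N) e = ⊕-cong (e 0 (suc N) refl) (antidiag-cong N (λ i j eq → e (suc i) j (cong suc eq)))

  antidiag-zero : ∀ N {F : ℕ → ℕ → Lin W} → (∀ i j → i + j ≡ N → F i j ≋ zeroL) → antidiag F N ≋ zeroL
  antidiag-zero zero e = e 0 0 refl
  antidiag-zero (suc N) e = ⊕-cong (e 0 (suc N) refl) (antidiag-zero N (λ i j eq → e (suc i) j (cong suc eq)))

  antidiag-⊕ : ∀ N (F G : ℕ → ℕ → Lin W) →
    antidiag (λ i j → F i j ⊕ G i j) N ≋ (antidiag F N ⊕ antidiag G N)
  antidiag-⊕ zero F G = ≋-refl
  antidiag-⊕ (suc N) F G = ≋-trans
    (⊕-congʳ (F 0 (suc N) ⊕ G 0 (suc N)) (antidiag-⊕ N (λ i j → F (suc i) j) (λ i j → G (suc i) j)))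
    (⊕-interchange (F 0 (suc N)) (G 0 (suc N)) (antidiag (λ i j → F (suc i) j) N) (antidiag (λ i j → G (suc i) j) N))

  antidiag-unsnoc : ∀ N (F : ℕ → ℕ → Lin W) → antidiag F (suc N) ≋ (antidiag (λ i j → F i (suc j)) N ⊕ F (suc N) 0)
  antidiag-unsnoc zero F = ≋-refl
  antidiag-unsnoc (suc N) F = ≋-trans (⊕-congʳ (F 0 (suc (suc N))) (antidiag-unsnoc N (λ i j → F (suc i) j)))
    (≋-sym (⊕-assoc (F 0 (suc (suc N))) (antidiag (λ i j → F (suc i) (suc j)) N) (F (suc (suc N)) 0)))

  antidiag-flip : ∀ N (F : ℕ → ℕ → Lin W) → antidiag F N ≋ antidiag (λ i j → F j i) N
  antidiag-flip zero F = ≋-refl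
  antidiag-flip (suc N) F = ≋-trans (⊕-congʳ (F 0 (suc N)) (antidiag-flip N (λ i j → F (suc i) j)))
    (≋-trans (⊕-comm (F 0 (suc N)) (antidiag (λ i j → F (suc j) i) N)) (≋-sym (antidiag-unsnoc N (λ i j → F j i))))

  antidiag-assoc : ∀ N (F : ℕ → ℕ → ℕ → Lin W) →
    antidiag (λ i m → antidiag (λ j k → F i j k) m) N ≋ antidiag (λ m k → antidiag (λ i j → F i j k) m) N
  antidiag-assoc zero F = ≋-refl
  antidiag-assoc (suc N) F = ≋-trans
    (⊕-congʳ (antidiag (λ j k → F 0 j k) (suc N)) (antidiag-assoc N (λ i j k → F (suc i) j k)))
    (≋-trans (⊕-assoc (F 0 0 (suc N)) (antidiag (λ m k → F 0 (suc m) k) N) _)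
      (⊕-congʳ (F 0 0 (suc N)) (≋-sym (antidiag-⊕ N (λ m k → F 0 (suc m) k)
        (λ m k → antidiag (λ i j → F (suc i) j k) m)))))

  linear-antidiag : ∀ N {H : Lin W → Lin W} → IsLinear H → (F : ℕ → ℕ → Lin W) →
    H (antidiag F N) ≋ antidiag (λ i j → H (F i j)) N
  linear-antidiag zero H-lin F = ≋-refl
  linear-antidiag (suc N) {H} H-lin F = ≋-trans (linear-⊕ H-lin (F 0 (suc N)) (antidiag (λ i j → F (suc i) j) N))
    (⊕-congʳ (H (F 0 (suc N))) (linear-antidiag N H-lin (λ i j → F (suc i) j)))

  antidiag-weight : ∀ N c (F : ℕ → ℕ → Lin W) →
    antidiag (λ i j → toℚ (c + i + j) • F i j) N ≋ toℚ (c + N) • antidiag F N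
  antidiag-weight zero c F = •-≡ (F 0 0) (cong toℚ (ℕP.+-identityʳ (c + 0)))
  antidiag-weight (suc N) c F = ≋-trans
    (⊕-cong (•-≡ (F 0 (suc N)) (cong (λ t → toℚ (t + suc N)) (ℕP.+-identityʳ c)))
      (≋-trans (antidiag-cong N (λ i j _ → •-≡ (F (suc i) j) (cong (λ t → toℚ (t + j)) (ℕP.+-suc c i))))
        (≋-trans (antidiag-weight N (suc c) (λ i j → F (suc i) j))
          (•-≡ (antidiag (λ i j → F (suc i) j) N) (cong toℚ (sym (ℕP.+-suc c N)))))))
    (≋-sym (•-distribˡ-⊕ (toℚ (c + suc N)) (F 0 (suc N)) (antidiag (λ i j → F (suc i) j) N)))

  sumBelow-cong : ∀ N {F G : ℕ → Lin W} → (∀ n → F n ≋ G n) → sumBelow F N ≋ sumBelow G N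
  sumBelow-cong zero e = ≋-refl
  sumBelow-cong (suc N) e = ⊕-cong (e 0) (sumBelow-cong N (λ n → e (suc n)))

  linear-sumBelow : ∀ N {H : Lin W → Lin W} → IsLinear H → (F : ℕ → Lin W) →
    H (sumBelow F N) ≋ sumBelow (λ n → H (F n)) N
  linear-sumBelow zero H-lin F = linear-zero H-lin
  linear-sumBelow (suc N) {H} H-lin F = ≋-trans (linear-⊕ H-lin (F 0) (sumBelow (λ n → F (suc n)) N))
    (⊕-congʳ (H (F 0)) (linear-sumBelow N H-lin (λ n → F (suc n))))

  sumBelow-unsnoc : ∀ N (F : ℕ → Lin W) → sumBelow F (suc N) ≋ (sumBelow F N ⊕ F N)
  sumBelow-unsnoc zero F = ⊕-identityʳ (F 0)
  sumBelow-unsnoc (suc N) F = ≋-trans (⊕-congʳ (F 0) (sumBelow-unsnoc N (λ n → F (suc n))))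
    (≋-sym (⊕-assoc (F 0) (sumBelow (λ n → F (suc n)) N) (F (suc N))))

  antidiag-sumBelow : ∀ N K (F : ℕ → ℕ → ℕ → Lin W) →
    antidiag (λ i j → sumBelow (λ n → F n i j) K) N ≋ sumBelow (λ n → antidiag (F n) N) K
  antidiag-sumBelow N zero F = antidiag-zero N (λ i j _ → ≋-refl)
  antidiag-sumBelow N (suc K) F = ≋-trans (antidiag-⊕ N (F 0) (λ i j → sumBelow (λ n → F (suc n) i j) K))
    (⊕-congʳ (antidiag (F 0) N) (antidiag-sumBelow N K (λ n → F (suc n))))

  sumBelow-telescope : ∀ K (G : ℕ → Lin W) →
    (sumBelow G K ⊕ sumBelow (λ n → -1ℚ • G (suc n)) K) ≋ (G 0 ⊕ -1ℚ • G K)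
  sumBelow-telescope zero G = ≋-sym (⊕-inverseʳ (G 0))
  sumBelow-telescope (suc K) G = begin
    (G 0 ⊕ sumBelow G' K) ⊕ (-1ℚ • G 1 ⊕ sumBelow (λ n → -1ℚ • G' (suc n)) K)
      ≈⟨ ⊕-interchange (G 0) (sumBelow G' K) (-1ℚ • G 1) _ ⟩
    (G 0 ⊕ -1ℚ • G 1) ⊕ (sumBelow G' K ⊕ sumBelow (λ n → -1ℚ • G' (suc n)) K)
      ≈⟨ ⊕-congʳ (G 0 ⊕ -1ℚ • G 1) (sumBelow-telescope K G') ⟩
    (G 0 ⊕ -1ℚ • G 1) ⊕ (G 1 ⊕ -1ℚ • G (suc K))
      ≈⟨ ⊕-assoc (G 0) (-1ℚ • G 1) _ ⟩
    G 0 ⊕ (-1ℚ • G 1 ⊕ (G 1 ⊕ -1ℚ • G (suc K)))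
      ≈⟨ ⊕-congʳ (G 0) (≋-trans (≋-sym (⊕-assoc (-1ℚ • G 1) (G 1) _))
           (⊕-zeroˡ (≋-trans (⊕-comm (-1ℚ • G 1) (G 1)) (⊕-inverseʳ (G 1))))) ⟩
    G 0 ⊕ -1ℚ • G (suc K) ∎
    where
    open ≋-Reasoning
    G' = λ n → G (suc n)

  sumBelow-extend : ∀ (G : ℕ → Lin W) N → (∀ n → N ≤ n → G n ≋ zeroL) → ∀ d → sumBelow G (d + N) ≋ sumBelow G N
  sumBelow-extend G N z zero = ≋-refl
  sumBelow-extend G N z (suc d) = ≋-trans (sumBelow-unsnoc (d + N) G)
    (≋-trans (⊕-cong (sumBelow-extend G N z d) (z (d + N) (ℕP.m≤n+m N d))) (⊕-identityʳ (sumBelow G N)))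

-- The logarithm of 1 + f in a commutative algebra of series

module Logarithm {A : Set} (_⋆_ : Lin (List A) → Lin (List A) → Lin (List A))
  (⋆-linearˡ : ∀ r → IsLinear (λ p → p ⋆ r)) (⋆-linearʳ : ∀ p → IsLinear (λ r → p ⋆ r))
  (⋆-assoc : ∀ p q r → ((p ⋆ q) ⋆ r) ≋ (p ⋆ (q ⋆ r)))
  (⋆-comm : ∀ p r → (p ⋆ r) ≋ (r ⋆ p))
  (⋆-identityʳ : ∀ p → (p ⋆ single []) ≋ p)
  (f : Ser (List A)) (f-0 : f 0 ≡ zeroL) where

  S : Set
  S = Ser (List A)

  ⋆-cong : ∀ {p p' r r'} → p ≋ p' → r ≋ r' → (p ⋆ r) ≋ (p' ⋆ r')
  ⋆-cong {p' = p'} {r = r} e e' = ≋-trans (linear-cong (⋆-linearˡ r) e) (linear-cong (⋆-linearʳ p') e')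

  infixr 7 _⊛_
  _⊛_ : S → S → S
  (a ⊛ b) N = antidiag (λ i j → a i ⋆ b j) N

  θ : S → S
  θ a N = toℚ N • a N

  ⊛-cong : ∀ {a a' b b' : S} → (∀ i → a i ≋ a' i) → (∀ j → b j ≋ b' j) → ∀ N → (a ⊛ b) N ≋ (a' ⊛ b') N
  ⊛-cong ea eb N = antidiag-cong N (λ i j _ → ⋆-cong (ea i) (eb j))

  ⊛-congʳ : ∀ a {b b' : S} → (∀ j → b j ≋ b' j) → ∀ N → (a ⊛ b) N ≋ (a ⊛ b') N
  ⊛-congʳ a = ⊛-cong {a} {a} (λ i → ≋-refl)

  ⊛-assoc : ∀ a b c N → (a ⊛ (b ⊛ c)) N ≋ ((a ⊛ b) ⊛ c) N
  ⊛-assoc a b c N =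
    ≋-trans (antidiag-cong N (λ i m _ → linear-antidiag m (⋆-linearʳ (a i)) (λ j k → b j ⋆ c k)))
    (≋-trans (antidiag-assoc N (λ i j k → a i ⋆ (b j ⋆ c k)))
    (≋-trans (antidiag-cong N (λ m k _ → antidiag-cong m (λ i j _ → ≋-sym (⋆-assoc (a i) (b j) (c k)))))
      (antidiag-cong N (λ m k _ → ≋-sym (linear-antidiag m (⋆-linearˡ (c k)) (λ i j → a i ⋆ b j))))))

  ⊛-comm : ∀ a b N → (a ⊛ b) N ≋ (b ⊛ a) N
  ⊛-comm a b N = ≋-trans (antidiag-flip N (λ i j → a i ⋆ b j)) (antidiag-cong N (λ i j _ → ⋆-comm (a j) (b i)))

  ⊛-leftComm : ∀ a b c N → (a ⊛ (b ⊛ c)) N ≋ (b ⊛ (a ⊛ c)) N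
  ⊛-leftComm a b c N = ≋-trans (⊛-assoc a b c N)
    (≋-trans (⊛-cong {a ⊛ b} {b ⊛ a} {c} {c} (⊛-comm a b) (λ j → ≋-refl) N) (≋-sym (⊛-assoc b a c N)))

  ⊛-identityʳ : ∀ a N → (a ⊛ unitSer) N ≋ a N
  ⊛-identityʳ a zero = ⋆-identityʳ (a 0)
  ⊛-identityʳ a (suc M) = ≋-trans (antidiag-unsnoc M (λ i j → a i ⋆ unitSer j))
    (≋-trans (⊕-zeroˡ (antidiag-zero M (λ i j _ → linear-zero (⋆-linearʳ (a i))))) (⋆-identityʳ (a (suc M))))

  ⊛-•ʳ : ∀ c a b N → (a ⊛ (λ j → c • b j)) N ≋ c • (a ⊛ b) N
  ⊛-•ʳ c a b N = ≋-trans (antidiag-cong N (λ i j _ → linear-• (⋆-linearʳ (a i)) c (b j)))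
    (≋-sym (linear-antidiag N (scale-linear c (+ 0)) (λ i j → a i ⋆ b j)))

  ⊛-zeroʳ : ∀ a b N → (∀ j → b j ≋ zeroL) → (a ⊛ b) N ≋ zeroL
  ⊛-zeroʳ a b N z = antidiag-zero N (λ i j _ →
    ≋-trans (linear-cong (⋆-linearʳ (a i)) (z j)) (linear-zero (⋆-linearʳ (a i))))

  θ-leibniz : ∀ a b N → θ (a ⊛ b) N ≋ ((θ a ⊛ b) N ⊕ (a ⊛ θ b) N)
  θ-leibniz a b N = ≋-trans (≋-sym (antidiag-weight N 0 (λ i j → a i ⋆ b j)))
    (≋-trans (antidiag-cong N (λ i j _ → ≋-trans (•-≡ (a i ⋆ b j) (toℚ-+ i j))
       (≋-trans (•-distribʳ-+ (toℚ i) (toℚ j) (a i ⋆ b j))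
         (⊕-cong (≋-sym (linear-• (⋆-linearˡ (b j)) (toℚ i) (a i)))
                 (≋-sym (linear-• (⋆-linearʳ (a i)) (toℚ j) (b j)))))))
      (antidiag-⊕ N (λ i j → θ a i ⋆ b j) (λ i j → a i ⋆ θ b j)))

  infix 8 f^_
  f^_ : ℕ → S
  f^ n = power _⋆_ f n

  power-suc : ∀ n N → (f^ suc n) N ≋ (f ⊛ f^ n) N
  power-suc n = concatMap-upTo-∸≋antidiag (λ i j → f i ⋆ (f^ n) j)

  f₀⋆ : ∀ p → (f 0 ⋆ p) ≋ zeroL
  f₀⋆ p rewrite f-0 = linear-zero (⋆-linearˡ p)

  θf₀⋆ : ∀ p → (θ f 0 ⋆ p) ≋ zeroL
  θf₀⋆ p = ≋-trans (linear-cong (⋆-linearˡ p) (•-zeroˡ (f 0))) (linear-zero (⋆-linearˡ p))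

  1+i+k≡j≤n⇒k<n : ∀ i k j n → suc i + k ≡ j → j ≤ n → k < n
  1+i+k≡j≤n⇒k<n i k j n refl j≤n = ℕP.<-≤-trans (s≤s (ℕP.m≤n+m k i)) j≤n

  power-vanish : ∀ n j → j < n → (f^ n) j ≋ zeroL
  power-vanish (suc n) j j<1+n = ≋-trans (power-suc n j) (antidiag-zero j λ where
    zero k _ → f₀⋆ ((f^ n) k)
    (suc i) k eq → ≋-trans (linear-cong (⋆-linearʳ (f (suc i)))
                             (power-vanish n k (1+i+k≡j≤n⇒k<n i k j n eq (ℕP.≤-pred j<1+n))))
                     (linear-zero (⋆-linearʳ (f (suc i)))))

  θf⊛power-vanish : ∀ n N → N ≤ n → (θ f ⊛ f^ n) N ≋ zeroL
  θf⊛power-vanish n N N≤n = antidiag-zero N λ where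
    zero k _ → θf₀⋆ ((f^ n) k)
    (suc i) k eq → ≋-trans (linear-cong (⋆-linearʳ (θ f (suc i)))
                             (power-vanish n k (1+i+k≡j≤n⇒k<n i k N n eq N≤n)))
                     (linear-zero (⋆-linearʳ (θ f (suc i))))

  θ-power : ∀ n N → θ (f^ suc n) N ≋ toℚ (suc n) • (θ f ⊛ f^ n) N
  f⊛θ-power : ∀ n N → (f ⊛ θ (f^ n)) N ≋ toℚ n • (θ f ⊛ f^ n) N

  θ-power n N = begin
    θ (f^ suc n) N                           ≈⟨ •-cong (toℚ N) (power-suc n N) ⟩
    θ (f ⊛ f^ n) N                           ≈⟨ θ-leibniz f (f^ n) N ⟩
    (θ f ⊛ f^ n) N ⊕ (f ⊛ θ (f^ n)) N        ≈⟨ ⊕-cong (≋-sym (•-identityˡ _)) (f⊛θ-power n N) ⟩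
    1ℚ • (θ f ⊛ f^ n) N ⊕ toℚ n • (θ f ⊛ f^ n) N ≈⟨ ≋-sym (•-distribʳ-+ 1ℚ (toℚ n) _) ⟩
    (1ℚ ℚ.+ toℚ n) • (θ f ⊛ f^ n) N          ≈⟨ •-≡ _ (sym (toℚ-+ 1 n)) ⟩
    toℚ (suc n) • (θ f ⊛ f^ n) N             ∎
    where open ≋-Reasoning

  f⊛θ-power zero N = ≋-trans (⊛-zeroʳ f (θ (f^ 0)) N θ1≋0) (≋-sym (•-zeroˡ _))
    where
    θ1≋0 : ∀ j → θ (f^ 0) j ≋ zeroL
    θ1≋0 zero = •-zeroˡ (single [])
    θ1≋0 (suc j) = ≋-refl
  f⊛θ-power (suc m) N = begin
    (f ⊛ θ (f^ suc m)) N                           ≈⟨ ⊛-congʳ f (θ-power m) N ⟩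
    (f ⊛ (λ j → toℚ (suc m) • (θ f ⊛ f^ m) j)) N   ≈⟨ ⊛-•ʳ (toℚ (suc m)) f (θ f ⊛ f^ m) N ⟩
    toℚ (suc m) • (f ⊛ (θ f ⊛ f^ m)) N             ≈⟨ •-cong (toℚ (suc m)) (⊛-leftComm f (θ f) (f^ m) N) ⟩
    toℚ (suc m) • (θ f ⊛ (f ⊛ f^ m)) N
      ≈⟨ •-cong (toℚ (suc m)) (⊛-congʳ (θ f) (λ j → ≋-sym (power-suc m j)) N) ⟩
    toℚ (suc m) • (θ f ⊛ f^ suc m) N               ∎
    where open ≋-Reasoning

  logf : S
  logf = logSer _⋆_ f

  term : ℕ → ℕ → Lin (List A)
  term n N = sign n • (θ f ⊛ f^ n) N

  θ-log : ∀ N → θ logf N ≋ sumBelow (λ n → term n N) N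
  θ-log N = begin
    toℚ N • logSer _⋆_ f N
      ≈⟨ •-cong (toℚ N) (≡⇒≋ (concatMap-upTo≡sumBelow (λ n → logCoef n • (f^ suc n) N) N)) ⟩
    toℚ N • sumBelow (λ n → logCoef n • (f^ suc n) N) N
      ≈⟨ linear-sumBelow N (scale-linear (toℚ N) (+ 0)) (λ n → logCoef n • (f^ suc n) N) ⟩
    sumBelow (λ n → toℚ N • logCoef n • (f^ suc n) N) N
      ≈⟨ sumBelow-cong N (λ n → ≋-trans (•-comm (toℚ N) (logCoef n) _) (•-cong (logCoef n) (θ-power n N))) ⟩
    sumBelow (λ n → logCoef n • toℚ (suc n) • (θ f ⊛ f^ n) N) N
      ≈⟨ sumBelow-cong N (λ n → ≋-trans (•-assoc (logCoef n) (toℚ (suc n)) _)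
           (•-≡ _ (trans (ℚP.*-comm (logCoef n) (toℚ (suc n))) (toℚ*logCoef n)))) ⟩
    sumBelow (λ n → term n N) N ∎
    where open ≋-Reasoning

  term-vanish : ∀ n N → N ≤ n → term n N ≋ zeroL
  term-vanish n N N≤n = linear-cong (scale-linear (sign n) (+ 0)) (θf⊛power-vanish n N N≤n)

  θ-log-extend : ∀ N d → θ logf N ≋ sumBelow (λ n → term n N) (d + N)
  θ-log-extend N d = ≋-trans (θ-log N) (≋-sym (sumBelow-extend (λ n → term n N) N (λ n → term-vanish n N) d))

  f⊛term : ∀ n N → (f ⊛ term n) N ≋ -1ℚ • term (suc n) N
  f⊛term n N = begin
    (f ⊛ term n) N                   ≈⟨ ⊛-•ʳ (sign n) f (θ f ⊛ f^ n) N ⟩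
    sign n • (f ⊛ (θ f ⊛ f^ n)) N    ≈⟨ •-cong (sign n) (⊛-leftComm f (θ f) (f^ n) N) ⟩
    sign n • (θ f ⊛ (f ⊛ f^ n)) N    ≈⟨ •-cong (sign n) (⊛-congʳ (θ f) (λ j → ≋-sym (power-suc n j)) N) ⟩
    sign n • (θ f ⊛ f^ suc n) N      ≈⟨ •-≡ _ (trans (sym (-1*-s≡s (sign n))) (cong (-1ℚ ℚ.*_) (sym (sign-suc n)))) ⟩
    (-1ℚ ℚ.* sign (suc n)) • (θ f ⊛ f^ suc n) N ≈⟨ ≋-sym (•-assoc -1ℚ (sign (suc n)) _) ⟩
    -1ℚ • term (suc n) N             ∎
    where
    open ≋-Reasoning
    -1*-s≡s : ∀ s → -1ℚ ℚ.* (ℚ.- s) ≡ s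
    -1*-s≡s = solve-∀ ℚ-ring

  log-newton : ∀ N → (θ logf N ⊕ (f ⊛ θ logf) N) ≋ θ f N
  log-newton N = begin
    θ logf N ⊕ (f ⊛ θ logf) N
      ≈⟨ ⊕-cong (θ-log-extend N 1) f⊛θlog ⟩
    sumBelow (λ n → term n N) (suc N) ⊕ sumBelow (λ n → -1ℚ • term (suc n) N) (suc N)
      ≈⟨ sumBelow-telescope (suc N) (λ n → term n N) ⟩
    term 0 N ⊕ -1ℚ • term (suc N) N
      ≈⟨ ⊕-zeroʳ (linear-cong (scale-linear -1ℚ (+ 0)) (term-vanish (suc N) N (ℕP.n≤1+n N))) ⟩
    term 0 N
      ≈⟨ •-identityˡ _ ⟩
    (θ f ⊛ unitSer) N
      ≈⟨ ⊛-identityʳ (θ f) N ⟩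
    θ f N ∎
    where
    open ≋-Reasoning
    f⊛θlog : (f ⊛ θ logf) N ≋ sumBelow (λ n → -1ℚ • term (suc n) N) (suc N)
    f⊛θlog = ≋-trans (antidiag-cong N (λ i j i+j≡N → linear-cong (⋆-linearʳ (f i))
               (≋-trans (θ-log-extend j (suc i)) (≡⇒≋ (cong (sumBelow (λ n → term n j)) (cong suc i+j≡N))))))
      (≋-trans (antidiag-cong N (λ i j _ → linear-sumBelow (suc N) (⋆-linearʳ (f i)) (λ n → term n j)))
      (≋-trans (antidiag-sumBelow N (suc N) (λ n i j → f i ⋆ term n j))
        (sumBelow-cong (suc N) (λ n → f⊛term n N))))

  newton-unique : ∀ (a b : S) → (∀ N → (a N ⊕ (f ⊛ a) N) ≋ (b N ⊕ (f ⊛ b) N)) →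
    ∀ N j → j ≤ N → a j ≋ b j
  newton-unique a b e zero .zero ℕ.z≤n = ⊕-cancelʳ (≋-trans (≋-sym (⊕-congʳ (a 0) (f₀⋆ (a 0))))
    (≋-trans (e 0) (⊕-congʳ (b 0) (f₀⋆ (b 0)))))
  newton-unique a b e (suc N) j j≤1+N with ℕP.m≤n⇒m<n∨m≡n j≤1+N
  ... | inj₁ j<1+N = newton-unique a b e N j (ℕP.≤-pred j<1+N)
  ... | inj₂ refl = ⊕-cancelʳ (≋-trans (e (suc N)) (⊕-congʳ (b (suc N)) (≋-sym f⊛a≋f⊛b)))
    where
    f⊛a≋f⊛b : (f ⊛ a) (suc N) ≋ (f ⊛ b) (suc N)
    f⊛a≋f⊛b = antidiag-cong (suc N) {λ i j → f i ⋆ a j} {λ i j → f i ⋆ b j} λ where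
      zero k _ → ≋-trans (f₀⋆ (a k)) (≋-sym (f₀⋆ (b k)))
      (suc i) k eq → ⋆-cong (≋-refl {p = f (suc i)})
        (newton-unique a b e N k (ℕP.≤-pred (1+i+k≡j≤n⇒k<n i k (suc N) (suc N) eq ℕP.≤-refl)))

  logSer-unique : ∀ (P : S) → P 0 ≋ zeroL → (∀ N → (θ P N ⊕ (f ⊛ θ P) N) ≋ θ f N) → ∀ N → logf N ≋ P N
  logSer-unique P P₀ newton zero = ≋-sym P₀
  logSer-unique P P₀ newton (suc N) =
    •-cancelˡ (toℚ (suc N)) (+ 1 ℚ./ suc N) (1/[1+n]*toℚ[1+n]≡1 N)
      (newton-unique (θ logf) (θ P) (λ M → ≋-trans (log-newton M) (≋-sym (newton M))) (suc N) (suc N) ℕP.≤-refl)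

-- Quasi-shuffle algebras

module QuasiShuffle (L : Set) (_∘ₗ_ : L → L → Lin L) where

  quasiShuffle : List L → List L → Lin (List L)
  quasiShuffle [] v = single v
  quasiShuffle (x ∷ u) [] = single (x ∷ u)
  quasiShuffle (x ∷ u) (y ∷ v) =
    pre x (quasiShuffle u (y ∷ v)) ⊕ (pre y (quasiShuffle (x ∷ u) v)
      ⊕ bilin (λ z w → single (z ∷ w)) (x ∘ₗ y) (quasiShuffle u v))

  cons : L → List L → Lin (List L)
  cons z u = single (z ∷ u)

  infixr 7 _⋆_
  _⋆_ : Lin (List L) → Lin (List L) → Lin (List L)
  _⋆_ = bilin quasiShuffle

  infixr 8 _▷_
  _▷_ : Lin L → Lin (List L) → Lin (List L)
  _▷_ = bilin cons

  _∘_ : Lin L → Lin L → Lin L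
  _∘_ = bilin _∘ₗ_

  ⋆-linearˡ : ∀ r → IsLinear (λ p → p ⋆ r)
  ⋆-linearˡ = bilin-linearˡ quasiShuffle

  ⋆-linearʳ : ∀ p → IsLinear (λ r → p ⋆ r)
  ⋆-linearʳ = bilin-linearʳ quasiShuffle

  ▷-linearˡ : ∀ p → IsLinear (λ c → c ▷ p)
  ▷-linearˡ = bilin-linearˡ cons

  ▷-linearʳ : ∀ c → IsLinear (λ p → c ▷ p)
  ▷-linearʳ = bilin-linearʳ cons

  ∘-linearˡ : ∀ d → IsLinear (λ c → c ∘ d)
  ∘-linearˡ = bilin-linearˡ _∘ₗ_

  ∘-linearʳ : ∀ c → IsLinear (λ d → c ∘ d)
  ∘-linearʳ = bilin-linearʳ _∘ₗ_

  ⋆-cong : ∀ {p p' r r'} → p ≋ p' → r ≋ r' → (p ⋆ r) ≋ (p' ⋆ r')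
  ⋆-cong = bilin-cong quasiShuffle

  ⋆-congˡ : ∀ r {p p'} → p ≋ p' → (p ⋆ r) ≋ (p' ⋆ r)
  ⋆-congˡ r = linear-cong (⋆-linearˡ r)

  ⋆-congʳ : ∀ p {r r'} → r ≋ r' → (p ⋆ r) ≋ (p ⋆ r')
  ⋆-congʳ p = linear-cong (⋆-linearʳ p)

  ▷-cong : ∀ {c c' p p'} → c ≋ c' → p ≋ p' → (c ▷ p) ≋ (c' ▷ p')
  ▷-cong = bilin-cong cons

  ▷-congˡ : ∀ p {c c'} → c ≋ c' → (c ▷ p) ≋ (c' ▷ p)
  ▷-congˡ p = linear-cong (▷-linearˡ p)

  ▷-congʳ : ∀ c {p p'} → p ≋ p' → (c ▷ p) ≋ (c ▷ p')
  ▷-congʳ c = linear-cong (▷-linearʳ c)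

  single-⋆-single : ∀ u v → (single u ⋆ single v) ≋ quasiShuffle u v
  single-⋆-single = bilin-single quasiShuffle

  single-▷-single : ∀ x u → (single x ▷ single u) ≋ single (x ∷ u)
  single-▷-single = bilin-single cons

  single-▷ : ∀ x p → (single x ▷ p) ≋ pre x p
  single-▷ x = linear-ext (▷-linearʳ (single x)) (pre-linear x) (single-▷-single x)

  ⋆-identityˡ : ∀ p → (single [] ⋆ p) ≋ p
  ⋆-identityˡ = linear-ext (⋆-linearʳ (single [])) id-linear (single-⋆-single [])

  ⋆-identityʳ : ∀ p → (p ⋆ single []) ≋ p
  ⋆-identityʳ = linear-ext (⋆-linearˡ (single [])) id-linear λ where
    [] → ≋-refl
    (x ∷ u) → ≋-refl

  expand : Lin L → Lin (List L) → Lin L → Lin (List L) → Lin (List L)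
  expand c p d q = (c ▷ (p ⋆ (d ▷ q))) ⊕ ((d ▷ ((c ▷ p) ⋆ q)) ⊕ ((c ∘ d) ▷ (p ⋆ q)))

  ▷-⋆-▷ : ∀ c p d q → ((c ▷ p) ⋆ (d ▷ q)) ≋ expand c p d q
  ▷-⋆-▷ c p d q = linear-ext
    (∘-linear (⋆-linearˡ (d ▷ q)) (▷-linearˡ p))
    (⊕-linear (▷-linearˡ (p ⋆ (d ▷ q)))
      (⊕-linear (∘-linear (▷-linearʳ d) (∘-linear (⋆-linearˡ q) (▷-linearˡ p)))
                (∘-linear (▷-linearˡ (p ⋆ q)) (∘-linearˡ d))))
    (λ x → linear-ext
      (∘-linear (⋆-linearˡ (d ▷ q)) (▷-linearʳ (single x)))
      (⊕-linear (∘-linear (▷-linearʳ (single x)) (⋆-linearˡ (d ▷ q)))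
        (⊕-linear (∘-linear (▷-linearʳ d) (∘-linear (⋆-linearˡ q) (▷-linearʳ (single x))))
                  (∘-linear (▷-linearʳ (single x ∘ d)) (⋆-linearˡ q))))
      (λ u → linear-ext
        (∘-linear (⋆-linearʳ (single x ▷ single u)) (▷-linearˡ q))
        (⊕-linear (∘-linear (▷-linearʳ (single x)) (∘-linear (⋆-linearʳ (single u)) (▷-linearˡ q)))
          (⊕-linear (▷-linearˡ ((single x ▷ single u) ⋆ q))
                    (∘-linear (▷-linearˡ (single u ⋆ q)) (∘-linearʳ (single x)))))
        (λ y → linear-ext
          (∘-linear (⋆-linearʳ (single x ▷ single u)) (▷-linearʳ (single y)))
          (⊕-linear (∘-linear (▷-linearʳ (single x)) (∘-linear (⋆-linearʳ (single u)) (▷-linearʳ (single y))))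
            (⊕-linear (∘-linear (▷-linearʳ (single y)) (⋆-linearʳ (single x ▷ single u)))
                      (∘-linear (▷-linearʳ (single x ∘ single y)) (⋆-linearʳ (single u)))))
          (onWords x u y) q) d) p) c
    where
    onWords : ∀ x u y v →
      ((single x ▷ single u) ⋆ (single y ▷ single v)) ≋ expand (single x) (single u) (single y) (single v)
    onWords x u y v = ≋-trans (⋆-cong (single-▷-single x u) (single-▷-single y v))
      (≋-trans (single-⋆-single (x ∷ u) (y ∷ v)) (≋-sym (⊕-cong
        (≋-trans (single-▷ x _) (linear-cong (pre-linear x)
          (≋-trans (⋆-congʳ (single u) (single-▷-single y v)) (single-⋆-single u (y ∷ v)))))
        (⊕-cong
          (≋-trans (single-▷ y _) (linear-cong (pre-linear y)
            (≋-trans (⋆-congˡ (single v) (single-▷-single x u)) (single-⋆-single (x ∷ u) v))))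
          (▷-cong (bilin-single _∘ₗ_ x y) (single-⋆-single u v))))))

  module Laws (∘ₗ-comm : ∀ x y → (x ∘ₗ y) ≋ (y ∘ₗ x))
              (∘ₗ-assoc : ∀ x y z → ((single x ∘ single y) ∘ single z) ≋ (single x ∘ (single y ∘ single z))) where

    quasiShuffle-comm : ∀ u v → quasiShuffle u v ≋ quasiShuffle v u
    quasiShuffle-comm [] [] = ≋-refl
    quasiShuffle-comm [] (y ∷ v) = ≋-refl
    quasiShuffle-comm (x ∷ u) [] = ≋-refl
    quasiShuffle-comm (x ∷ u) (y ∷ v) =
      ≋-trans (⊕-cong (linear-cong (pre-linear x) (quasiShuffle-comm u (y ∷ v)))
                (⊕-cong (linear-cong (pre-linear y) (quasiShuffle-comm (x ∷ u) v))
                        (▷-cong (∘ₗ-comm x y) (quasiShuffle-comm u v))))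
        (⊕-swap (pre x (quasiShuffle (y ∷ v) u)) (pre y (quasiShuffle v (x ∷ u))) ((y ∘ₗ x) ▷ quasiShuffle v u))

    ⋆-comm : ∀ p r → (p ⋆ r) ≋ (r ⋆ p)
    ⋆-comm p r = linear-ext (⋆-linearʳ p) (⋆-linearˡ p) (λ v → linear-ext (⋆-linearˡ (single v)) (⋆-linearʳ (single v))
      (λ u → ≋-trans (single-⋆-single u v) (≋-trans (quasiShuffle-comm u v) (≋-sym (single-⋆-single v u)))) p) r

    private
      Assoc : List L → List L → List L → Set
      Assoc u v w = ((single u ⋆ single v) ⋆ single w) ≋ (single u ⋆ (single v ⋆ single w))

      assoc-resp : ∀ a b c {a' b' c'} → a ≋ a' → b ≋ b' → c ≋ c' →
        ((a' ⋆ b') ⋆ c') ≋ (a' ⋆ (b' ⋆ c')) → ((a ⋆ b) ⋆ c) ≋ (a ⋆ (b ⋆ c))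
      assoc-resp a b c ea eb ec e = ≋-trans (⋆-cong (⋆-cong ea eb) ec) (≋-trans e (≋-sym (⋆-cong ea (⋆-cong eb ec))))

      linear-⊕₃ : ∀ {F : Lin (List L) → Lin (List L)} → IsLinear F → ∀ a b c → F (a ⊕ (b ⊕ c)) ≋ (F a ⊕ (F b ⊕ F c))
      linear-⊕₃ F-lin a b c = ≋-trans (linear-⊕ F-lin a (b ⊕ c)) (⊕-congʳ _ (linear-⊕ F-lin b c))

      ∫-⊕₃ : ∀ g (a b c : Lin (List L)) → ∫ g (a ⊕ (b ⊕ c)) ≡ ∫ g a ℚ.+ (∫ g b ℚ.+ ∫ g c)
      ∫-⊕₃ g a b c = trans (∫-++ g a (b ⊕ c)) (cong (∫ g a ℚ.+_) (∫-++ g b c))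

      ∫-⊕₉ : ∀ g (a b c d e f h i j : Lin (List L)) →
        ∫ g ((a ⊕ (b ⊕ c)) ⊕ ((d ⊕ (e ⊕ f)) ⊕ (h ⊕ (i ⊕ j))))
          ≡ (∫ g a ℚ.+ (∫ g b ℚ.+ ∫ g c)) ℚ.+ ((∫ g d ℚ.+ (∫ g e ℚ.+ ∫ g f)) ℚ.+ (∫ g h ℚ.+ (∫ g i ℚ.+ ∫ g j)))
      ∫-⊕₉ g a b c d e f h i j = trans (∫-++ g (a ⊕ (b ⊕ c)) _) (cong₂ ℚ._+_ (∫-⊕₃ g a b c)
        (trans (∫-++ g (d ⊕ (e ⊕ f)) _) (cong₂ ℚ._+_ (∫-⊕₃ g d e f) (∫-⊕₃ g h i j))))

      regroup : ∀ {a₁ z₁ c₁ a₂ z₂ c₂ a₃ z₃ c₃ x₁ y₁ d₁ x₂ z d₂ x₃ yz d₃ : Lin (List L)} →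
        a₁ ≋ (x₁ ⊕ (x₂ ⊕ x₃)) → a₂ ≋ y₁ → (z₁ ⊕ (z₂ ⊕ z₃)) ≋ z → a₃ ≋ d₁ → c₁ ≋ d₂ → c₂ ≋ yz → c₃ ≋ d₃ →
        ((a₁ ⊕ (z₁ ⊕ c₁)) ⊕ ((a₂ ⊕ (z₂ ⊕ c₂)) ⊕ (a₃ ⊕ (z₃ ⊕ c₃))))
          ≋ ((x₁ ⊕ (y₁ ⊕ d₁)) ⊕ ((x₂ ⊕ (z ⊕ d₂)) ⊕ (x₃ ⊕ (yz ⊕ d₃))))
      regroup {a₁} {z₁} {c₁} {a₂} {z₂} {c₂} {a₃} {z₃} {c₃} {x₁} {y₁} {d₁} {x₂} {z} {d₂} {x₃} {yz} {d₃}
        e₁ e₂ e₃ e₄ e₅ e₆ e₇ = mk≋ λ g →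
        trans (∫-⊕₉ g a₁ z₁ c₁ a₂ z₂ c₂ a₃ z₃ c₃)
        (trans (cong (λ A → (A ℚ.+ (∫ g z₁ ℚ.+ ∫ g c₁))
                              ℚ.+ ((∫ g a₂ ℚ.+ (∫ g z₂ ℚ.+ ∫ g c₂)) ℚ.+ (∫ g a₃ ℚ.+ (∫ g z₃ ℚ.+ ∫ g c₃))))
            (trans (∫-≡ e₁ g) (∫-⊕₃ g x₁ x₂ x₃)))
        (trans (shuffle₁₁ (∫ g x₁) (∫ g x₂) (∫ g x₃) (∫ g z₁) (∫ g c₁) (∫ g a₂) (∫ g z₂) (∫ g c₂)
                          (∫ g a₃) (∫ g z₃) (∫ g c₃))
        (trans (subst₆ {X₁ = ∫ g x₁} {X₂ = ∫ g x₂} {X₃ = ∫ g x₃} (∫-≡ e₂ g) (∫-≡ e₄ g)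
                  (trans (sym (∫-⊕₃ g z₁ z₂ z₃)) (∫-≡ e₃ g)) (∫-≡ e₅ g) (∫-≡ e₆ g) (∫-≡ e₇ g))
        (sym (∫-⊕₉ g x₁ y₁ d₁ x₂ z d₂ x₃ yz d₃)))))
        where
        shuffle₁₁ : ∀ X₁ X₂ X₃ Z₁ C₁ A₂ Z₂ C₂ A₃ Z₃ C₃ →
          ((X₁ ℚ.+ (X₂ ℚ.+ X₃)) ℚ.+ (Z₁ ℚ.+ C₁)) ℚ.+ ((A₂ ℚ.+ (Z₂ ℚ.+ C₂)) ℚ.+ (A₃ ℚ.+ (Z₃ ℚ.+ C₃)))
            ≡ (X₁ ℚ.+ (A₂ ℚ.+ A₃)) ℚ.+ ((X₂ ℚ.+ ((Z₁ ℚ.+ (Z₂ ℚ.+ Z₃)) ℚ.+ C₁)) ℚ.+ (X₃ ℚ.+ (C₂ ℚ.+ C₃)))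
        shuffle₁₁ = solve-∀ ℚ-ring
        subst₆ : ∀ {A₂ Y₁ A₃ D₁ Zs Z C₁ D₂ C₂ YZ C₃ D₃ X₁ X₂ X₃ : ℚ} →
          A₂ ≡ Y₁ → A₃ ≡ D₁ → Zs ≡ Z → C₁ ≡ D₂ → C₂ ≡ YZ → C₃ ≡ D₃ →
          (X₁ ℚ.+ (A₂ ℚ.+ A₃)) ℚ.+ ((X₂ ℚ.+ (Zs ℚ.+ C₁)) ℚ.+ (X₃ ℚ.+ (C₂ ℚ.+ C₃)))
            ≡ (X₁ ℚ.+ (Y₁ ℚ.+ D₁)) ℚ.+ ((X₂ ℚ.+ (Z ℚ.+ D₂)) ℚ.+ (X₃ ℚ.+ (YZ ℚ.+ D₃)))
        subst₆ refl refl refl refl refl refl = refl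

      -- Expand both sides twice with ▷-⋆-▷; the nine resulting terms match by
      -- associativity on shorter words (the seven hypotheses).
      assoc-step : ∀ x u y v z w →
        Assoc u (y ∷ v) (z ∷ w) → Assoc (x ∷ u) v (z ∷ w) → Assoc (x ∷ u) (y ∷ v) w →
        Assoc u v (z ∷ w) → Assoc u (y ∷ v) w → Assoc (x ∷ u) v w → Assoc u v w →
        Assoc (x ∷ u) (y ∷ v) (z ∷ w)
      assoc-step x u y v z w iuVW iUvW iUVw iuvW iuVw iUvw iuvw =
        ≋-trans lhs (≋-trans (regroup
          {z₁ = ẑ ▷ ((x̂ ▷ P₁) ⋆ sw)} {z₂ = ẑ ▷ ((ŷ ▷ P₂) ⋆ sw)} {z₃ = ẑ ▷ (((x̂ ∘ ŷ) ▷ P₃) ⋆ sw)}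
          {x₁ = x̂ ▷ (su ⋆ (ŷ ▷ Q₁))} {x₂ = x̂ ▷ (su ⋆ (ẑ ▷ Q₂))} {x₃ = x̂ ▷ (su ⋆ ((ŷ ∘ ẑ) ▷ Q₃))}
          e₁ e₂ e₃ e₄ e₅ e₆ e₇) (≋-sym rhs))
        where
        x̂ = single x ; ŷ = single y ; ẑ = single z
        su = single u ; sv = single v ; sw = single w
        X̂ = x̂ ▷ su ; Ŷ = ŷ ▷ sv ; Ẑ = ẑ ▷ sw
        hU = ≋-sym (single-▷-single x u) ; hV = ≋-sym (single-▷-single y v) ; hW = ≋-sym (single-▷-single z w)
        P₁ = su ⋆ Ŷ ; P₂ = X̂ ⋆ sv ; P₃ = su ⋆ sv
        Q₁ = sv ⋆ Ẑ ; Q₂ = Ŷ ⋆ sw ; Q₃ = sv ⋆ sw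
        lhs : ((single (x ∷ u) ⋆ single (y ∷ v)) ⋆ single (z ∷ w))
              ≋ (expand x̂ P₁ ẑ sw ⊕ (expand ŷ P₂ ẑ sw ⊕ expand (x̂ ∘ ŷ) P₃ ẑ sw))
        lhs = ≋-trans (⋆-cong (⋆-cong hU hV) hW) (≋-trans (⋆-congˡ Ẑ (▷-⋆-▷ x̂ su ŷ sv))
                (≋-trans (linear-⊕₃ (⋆-linearˡ Ẑ) (x̂ ▷ P₁) (ŷ ▷ P₂) ((x̂ ∘ ŷ) ▷ P₃))
                  (⊕-cong (▷-⋆-▷ x̂ P₁ ẑ sw) (⊕-cong (▷-⋆-▷ ŷ P₂ ẑ sw) (▷-⋆-▷ (x̂ ∘ ŷ) P₃ ẑ sw)))))
        rhs : (single (x ∷ u) ⋆ (single (y ∷ v) ⋆ single (z ∷ w)))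
              ≋ (expand x̂ su ŷ Q₁ ⊕ (expand x̂ su ẑ Q₂ ⊕ expand x̂ su (ŷ ∘ ẑ) Q₃))
        rhs = ≋-trans (⋆-cong hU (⋆-cong hV hW)) (≋-trans (⋆-congʳ X̂ (▷-⋆-▷ ŷ sv ẑ sw))
                (≋-trans (linear-⊕₃ (⋆-linearʳ X̂) (ŷ ▷ Q₁) (ẑ ▷ Q₂) ((ŷ ∘ ẑ) ▷ Q₃))
                  (⊕-cong (▷-⋆-▷ x̂ su ŷ Q₁) (⊕-cong (▷-⋆-▷ x̂ su ẑ Q₂) (▷-⋆-▷ x̂ su (ŷ ∘ ẑ) Q₃)))))
        e₁ : (x̂ ▷ (P₁ ⋆ Ẑ)) ≋ ((x̂ ▷ (su ⋆ (ŷ ▷ Q₁))) ⊕ ((x̂ ▷ (su ⋆ (ẑ ▷ Q₂))) ⊕ (x̂ ▷ (su ⋆ ((ŷ ∘ ẑ) ▷ Q₃)))))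
        e₁ = ≋-trans (▷-congʳ x̂ (assoc-resp su Ŷ Ẑ ≋-refl (≋-sym hV) (≋-sym hW) iuVW))
               (≋-trans (▷-congʳ x̂ (⋆-congʳ su (▷-⋆-▷ ŷ sv ẑ sw)))
                 (≋-trans (▷-congʳ x̂ (linear-⊕₃ (⋆-linearʳ su) (ŷ ▷ Q₁) (ẑ ▷ Q₂) ((ŷ ∘ ẑ) ▷ Q₃)))
                   (linear-⊕₃ (▷-linearʳ x̂) (su ⋆ (ŷ ▷ Q₁)) (su ⋆ (ẑ ▷ Q₂)) (su ⋆ ((ŷ ∘ ẑ) ▷ Q₃)))))
        e₂ : (ŷ ▷ (P₂ ⋆ Ẑ)) ≋ (ŷ ▷ (X̂ ⋆ Q₁))
        e₂ = ▷-congʳ ŷ (assoc-resp X̂ sv Ẑ (≋-sym hU) ≋-refl (≋-sym hW) iUvW)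
        e₃ : ((ẑ ▷ ((x̂ ▷ P₁) ⋆ sw)) ⊕ ((ẑ ▷ ((ŷ ▷ P₂) ⋆ sw)) ⊕ (ẑ ▷ (((x̂ ∘ ŷ) ▷ P₃) ⋆ sw)))) ≋ (ẑ ▷ (X̂ ⋆ Q₂))
        e₃ = ≋-trans (≋-sym (linear-⊕₃ (▷-linearʳ ẑ) ((x̂ ▷ P₁) ⋆ sw) ((ŷ ▷ P₂) ⋆ sw) (((x̂ ∘ ŷ) ▷ P₃) ⋆ sw)))
               (≋-trans (▷-congʳ ẑ (≋-sym (linear-⊕₃ (⋆-linearˡ sw) (x̂ ▷ P₁) (ŷ ▷ P₂) ((x̂ ∘ ŷ) ▷ P₃))))
                 (≋-trans (▷-congʳ ẑ (⋆-congˡ sw (≋-sym (▷-⋆-▷ x̂ su ŷ sv))))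
                   (▷-congʳ ẑ (assoc-resp X̂ Ŷ sw (≋-sym hU) (≋-sym hV) ≋-refl iUVw))))
        e₄ : ((x̂ ∘ ŷ) ▷ (P₃ ⋆ Ẑ)) ≋ ((x̂ ∘ ŷ) ▷ (su ⋆ Q₁))
        e₄ = ▷-congʳ (x̂ ∘ ŷ) (assoc-resp su sv Ẑ ≋-refl ≋-refl (≋-sym hW) iuvW)
        e₅ : ((x̂ ∘ ẑ) ▷ (P₁ ⋆ sw)) ≋ ((x̂ ∘ ẑ) ▷ (su ⋆ Q₂))
        e₅ = ▷-congʳ (x̂ ∘ ẑ) (assoc-resp su Ŷ sw ≋-refl (≋-sym hV) ≋-refl iuVw)
        e₆ : ((ŷ ∘ ẑ) ▷ (P₂ ⋆ sw)) ≋ ((ŷ ∘ ẑ) ▷ (X̂ ⋆ Q₃))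
        e₆ = ▷-congʳ (ŷ ∘ ẑ) (assoc-resp X̂ sv sw (≋-sym hU) ≋-refl ≋-refl iUvw)
        e₇ : (((x̂ ∘ ŷ) ∘ ẑ) ▷ (P₃ ⋆ sw)) ≋ ((x̂ ∘ (ŷ ∘ ẑ)) ▷ (su ⋆ Q₃))
        e₇ = ▷-cong (∘ₗ-assoc x y z) iuvw

      quasiShuffle-assoc : ∀ u v w → Assoc u v w
      quasiShuffle-assoc [] v w =
        ≋-trans (⋆-congˡ (single w) (⋆-identityˡ (single v))) (≋-sym (⋆-identityˡ (single v ⋆ single w)))
      quasiShuffle-assoc (x ∷ u) [] w =
        ≋-trans (⋆-congˡ (single w) (⋆-identityʳ (single (x ∷ u))))
          (⋆-congʳ (single (x ∷ u)) (≋-sym (⋆-identityˡ (single w))))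
      quasiShuffle-assoc (x ∷ u) (y ∷ v) [] =
        ≋-trans (⋆-identityʳ (single (x ∷ u) ⋆ single (y ∷ v)))
          (⋆-congʳ (single (x ∷ u)) (≋-sym (⋆-identityʳ (single (y ∷ v)))))
      quasiShuffle-assoc (x ∷ u) (y ∷ v) (z ∷ w) = assoc-step x u y v z w
        (quasiShuffle-assoc u (y ∷ v) (z ∷ w)) (quasiShuffle-assoc (x ∷ u) v (z ∷ w))
        (quasiShuffle-assoc (x ∷ u) (y ∷ v) w) (quasiShuffle-assoc u v (z ∷ w))
        (quasiShuffle-assoc u (y ∷ v) w) (quasiShuffle-assoc (x ∷ u) v w) (quasiShuffle-assoc u v w)

    ⋆-assoc : ∀ p q r → ((p ⋆ q) ⋆ r) ≋ (p ⋆ (q ⋆ r))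
    ⋆-assoc p q r = linear-ext (∘-linear (⋆-linearˡ r) (⋆-linearˡ q)) (⋆-linearˡ (q ⋆ r))
      (λ u → linear-ext (∘-linear (⋆-linearˡ r) (⋆-linearʳ (single u))) (∘-linear (⋆-linearʳ (single u)) (⋆-linearˡ r))
        (λ v → linear-ext (⋆-linearʳ (single u ⋆ single v)) (∘-linear (⋆-linearʳ (single u)) (⋆-linearʳ (single v)))
          (quasiShuffle-assoc u v) r) q) p

    -- log(1/(1 - l X)) in the quasi-shuffle algebra, with ∘-power j = l ∘ ⋯ ∘ l
    -- (j + 1 factors) given in closed form.
    module GeometricLog (l : L) (∘-power : ℕ → Lin L) (∘-power-zero : ∘-power 0 ≋ single l)
                        (∘-power-suc : ∀ j → (single l ∘ ∘-power j) ≋ ∘-power (suc j)) where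

      l^ : ℕ → Lin (List L)
      l^ i = single (replicate i l)

      geometric : Ser (List L)
      geometric zero = zeroL
      geometric (suc n) = l^ (suc n)

      letter : ℕ → Lin (List L)
      letter j = ∘-power j ▷ single []

      logGeometric : Ser (List L)
      logGeometric zero = zeroL
      logGeometric (suc n) = logCoef n • letter n

      -- insertions m c = Σ_{a + b = m} l^a c l^b
      insertions : ℕ → Lin L → Lin (List L)
      insertions zero c = c ▷ single []
      insertions (suc m) c = (c ▷ l^ (suc m)) ⊕ (single l ▷ insertions m c)

      -- the terms of l^i ⋆ letter j in which letter j is merged with one of the l's
      merges : ℕ → ℕ → Lin (List L)
      merges zero j = zeroL
      merges (suc i) j = insertions i (∘-power (suc j))

      insertions-congʳ : ∀ m {c c'} → c ≋ c' → insertions m c ≋ insertions m c'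
      insertions-congʳ zero e = ▷-congˡ (single []) e
      insertions-congʳ (suc m) e = ⊕-cong (▷-congˡ (l^ (suc m)) e) (▷-congʳ (single l) (insertions-congʳ m e))

      l▷l^ : ∀ k → (single l ▷ l^ k) ≋ l^ (suc k)
      l▷l^ k = single-▷-single l (replicate k l)

      l▷merges : ∀ i j → ((single l ▷ merges i j) ⊕ (∘-power (suc j) ▷ l^ i)) ≋ insertions i (∘-power (suc j))
      l▷merges zero j = ⊕-zeroˡ (linear-zero (▷-linearʳ (single l)))
      l▷merges (suc i) j = ⊕-comm (single l ▷ insertions i (∘-power (suc j))) (∘-power (suc j) ▷ l^ (suc i))

      l^⋆letter : ∀ i j → (l^ i ⋆ letter j) ≋ (insertions i (∘-power j) ⊕ merges i j)
      l^⋆letter zero j = ≋-trans (⋆-identityˡ (letter j)) (≋-sym (⊕-identityʳ (letter j)))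
      l^⋆letter (suc i) j = begin
        l^ (suc i) ⋆ letter j
          ≈⟨ ⋆-congˡ (letter j) (≋-sym (l▷l^ i)) ⟩
        (single l ▷ l^ i) ⋆ letter j
          ≈⟨ ▷-⋆-▷ (single l) (l^ i) (∘-power j) (single []) ⟩
        expand (single l) (l^ i) (∘-power j) (single [])
          ≈⟨ ⊕-cong (▷-congʳ (single l) (l^⋆letter i j))
               (⊕-cong (▷-congʳ (∘-power j) (≋-trans (⋆-identityʳ (single l ▷ l^ i)) (l▷l^ i)))
                       (▷-cong (∘-power-suc j) (⋆-identityʳ (l^ i)))) ⟩
        (single l ▷ (insertions i c ⊕ merges i j)) ⊕ ((c ▷ l^ (suc i)) ⊕ (∘-power (suc j) ▷ l^ i))
          ≈⟨ ⊕-congˡ _ (linear-⊕ (▷-linearʳ (single l)) (insertions i c) (merges i j)) ⟩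
        ((single l ▷ insertions i c) ⊕ (single l ▷ merges i j)) ⊕ ((c ▷ l^ (suc i)) ⊕ (∘-power (suc j) ▷ l^ i))
          ≈⟨ ⊕-interchange (single l ▷ insertions i c) _ (c ▷ l^ (suc i)) _ ⟩
        ((single l ▷ insertions i c) ⊕ (c ▷ l^ (suc i))) ⊕ ((single l ▷ merges i j) ⊕ (∘-power (suc j) ▷ l^ i))
          ≈⟨ ⊕-cong (⊕-comm (single l ▷ insertions i c) (c ▷ l^ (suc i))) (l▷merges i j) ⟩
        insertions (suc i) c ⊕ merges (suc i) j ∎
        where
        open ≋-Reasoning
        c = ∘-power j

      insertions-l : ∀ m → insertions m (∘-power 0) ≋ toℚ (suc m) • l^ (suc m)
      insertions-l zero = ≋-trans (insertions-congʳ 0 ∘-power-zero)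
        (≋-trans (single-▷-single l []) (≋-sym (•-identityˡ (l^ 1))))
      insertions-l (suc m) = begin
        (∘-power 0 ▷ l^ (suc m)) ⊕ (single l ▷ insertions m (∘-power 0))
          ≈⟨ ⊕-cong (≋-trans (▷-congˡ (l^ (suc m)) ∘-power-zero) (l▷l^ (suc m)))
               (≋-trans (▷-congʳ (single l) (insertions-l m))
                 (≋-trans (linear-• (▷-linearʳ (single l)) (toℚ (suc m)) (l^ (suc m)))
                   (•-cong (toℚ (suc m)) (l▷l^ (suc m))))) ⟩
        l^ (2 + m) ⊕ toℚ (suc m) • l^ (2 + m)
          ≈⟨ ⊕-congˡ _ (≋-sym (•-identityˡ (l^ (2 + m)))) ⟩
        1ℚ • l^ (2 + m) ⊕ toℚ (suc m) • l^ (2 + m)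
          ≈⟨ ≋-sym (•-distribʳ-+ 1ℚ (toℚ (suc m)) (l^ (2 + m))) ⟩
        (1ℚ ℚ.+ toℚ (suc m)) • l^ (2 + m)
          ≈⟨ •-≡ (l^ (2 + m)) (sym (toℚ-+ 1 (suc m))) ⟩
        toℚ (2 + m) • l^ (2 + m) ∎
        where open ≋-Reasoning

      open Logarithm _⋆_ ⋆-linearˡ ⋆-linearʳ ⋆-assoc ⋆-comm ⋆-identityʳ geometric refl
        using (θ; _⊛_; logSer-unique)

      θ-logGeometric : ∀ n → θ logGeometric (suc n) ≋ sign n • letter n
      θ-logGeometric n = ≋-trans (•-assoc (toℚ (suc n)) (logCoef n) (letter n)) (•-≡ (letter n) (toℚ*logCoef n))

      -- sign j • merges (i + 1) j cancels sign (j + 1) • insertions i (∘-power (j + 1)).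
      alternating-telescope : ∀ M →
        (antidiag (λ i j → sign j • insertions i (∘-power j)) M ⊕ antidiag (λ i j → sign j • merges i j) M)
          ≋ insertions M (∘-power 0)
      alternating-telescope zero = ≋-trans (⊕-identityʳ (sign 0 • insertions 0 (∘-power 0))) (•-identityˡ _)
      alternating-telescope (suc M) =
        ≋-trans (⊕-congˡ merged (antidiag-unsnoc M (λ i j → sign j • insertions i (∘-power j))))
        (≋-trans (⊕-assoc shifted last merged)
        (≋-trans (⊕-swap shifted last merged)
        (≋-trans (⊕-zeroʳ cancel) (•-identityˡ _))))
        where
        shifted = antidiag (λ i j → sign (suc j) • insertions i (∘-power (suc j))) M
        last = sign 0 • insertions (suc M) (∘-power 0)
        merged = antidiag (λ i j → sign j • insertions i (∘-power (suc j))) M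
        cancel : (shifted ⊕ merged) ≋ zeroL
        cancel = ≋-trans (≋-sym (antidiag-⊕ M (λ i j → sign (suc j) • ins i j) (λ i j → sign j • ins i j)))
          (antidiag-zero M (λ i j _ → ≋-trans (≋-sym (•-distribʳ-+ (sign (suc j)) (sign j) (ins i j)))
            (≋-trans (•-≡ (ins i j) (trans (cong (ℚ._+ sign j) (sign-suc j)) (ℚP.+-inverseˡ (sign j))))
              (•-zeroˡ (ins i j)))))
          where
          ins : ℕ → ℕ → Lin (List L)
          ins i j = insertions i (∘-power (suc j))

      logGeometric-newton : ∀ N → (θ logGeometric N ⊕ (geometric ⊛ θ logGeometric) N) ≋ θ geometric N
      logGeometric-newton zero = ≋-refl
      logGeometric-newton (suc M) = begin
        θP (suc M) ⊕ antidiag (λ i j → l^ (suc i) ⋆ θP j) M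
          ≈⟨ ⊕-congˡ _ (≋-sym (⋆-identityˡ (θP (suc M)))) ⟩
        antidiag (λ i j → l^ i ⋆ θP j) (suc M)
          ≈⟨ antidiag-unsnoc M (λ i j → l^ i ⋆ θP j) ⟩
        antidiag (λ i j → l^ i ⋆ θP (suc j)) M ⊕ (l^ (suc M) ⋆ zeroL)
          ≈⟨ ⊕-zeroʳ (linear-zero (⋆-linearʳ (l^ (suc M)))) ⟩
        antidiag (λ i j → l^ i ⋆ θP (suc j)) M
          ≈⟨ antidiag-cong M (λ i j _ → ≋-trans (⋆-congʳ (l^ i) (θ-logGeometric j))
               (≋-trans (linear-• (⋆-linearʳ (l^ i)) (sign j) (letter j))
                 (≋-trans (•-cong (sign j) (l^⋆letter i j))
                   (•-distribˡ-⊕ (sign j) (insertions i (∘-power j)) (merges i j))))) ⟩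
        antidiag (λ i j → sign j • insertions i (∘-power j) ⊕ sign j • merges i j) M
          ≈⟨ antidiag-⊕ M _ _ ⟩
        antidiag (λ i j → sign j • insertions i (∘-power j)) M ⊕ antidiag (λ i j → sign j • merges i j) M
          ≈⟨ alternating-telescope M ⟩
        insertions M (∘-power 0)
          ≈⟨ insertions-l M ⟩
        θ geometric (suc M) ∎
        where
        open ≋-Reasoning
        θP = θ logGeometric

      log-geometric : ∀ N → logSer _⋆_ geometric N ≋ logGeometric N
      log-geometric = logSer-unique logGeometric ≋-refl logGeometric-newton

module _ {V W : Set} where

  linExt-cong-≡ : ∀ {f h : V → Lin W} → (∀ v → f v ≡ h v) → ∀ p → linExt f p ≡ linExt h p
  linExt-cong-≡ e = ListP.concatMap-cong (λ { (q , k , v) → cong (scale q k) (e v) })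

  linear-concatMap : ∀ {Φ : Lin V → Lin W} → IsLinear Φ → ∀ (F : ℕ → Lin V) ns →
    Φ (concatMap F ns) ≋ concatMap (λ n → Φ (F n)) ns
  linear-concatMap Φ-lin F [] = linear-zero Φ-lin
  linear-concatMap Φ-lin F (n ∷ ns) =
    ≋-trans (linear-⊕ Φ-lin (F n) (concatMap F ns)) (⊕-congʳ _ (linear-concatMap Φ-lin F ns))

concatMap-cong-≋ : ∀ {W : Set} {F G : ℕ → Lin W} → (∀ n → F n ≋ G n) → ∀ ns → concatMap F ns ≋ concatMap G ns
concatMap-cong-≋ e [] = ≋-refl
concatMap-cong-≋ e (n ∷ ns) = ⊕-cong (e n) (concatMap-cong-≋ e ns)

module _ {A B : Set} (_⋆₁_ : Lin (List A) → Lin (List A) → Lin (List A))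
  (_⋆₂_ : Lin (List B) → Lin (List B) → Lin (List B))
  (⋆₂-cong : ∀ {p p' r r'} → p ≋ p' → r ≋ r' → (p ⋆₂ r) ≋ (p' ⋆₂ r'))
  {Φ : Lin (List A) → Lin (List B)} (Φ-linear : IsLinear Φ)
  (Φ-⋆ : ∀ p r → Φ (p ⋆₁ r) ≋ (Φ p ⋆₂ Φ r)) (Φ-1 : Φ (single []) ≋ single [])
  (f : Ser (List A)) (f' : Ser (List B)) (Φ-f : ∀ N → Φ (f N) ≋ f' N) where

  power-hom : ∀ n N → Φ (power _⋆₁_ f n N) ≋ power _⋆₂_ f' n N
  power-hom zero zero = Φ-1
  power-hom zero (suc N) = linear-zero Φ-linear
  power-hom (suc n) N = ≋-trans (linear-concatMap Φ-linear (λ i → f i ⋆₁ power _⋆₁_ f n (N ∸ i)) (upTo (suc N)))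
    (concatMap-cong-≋ (λ i → ≋-trans (Φ-⋆ (f i) _) (⋆₂-cong (Φ-f i) (power-hom n (N ∸ i)))) (upTo (suc N)))

  logSer-hom : ∀ N → Φ (logSer _⋆₁_ f N) ≋ logSer _⋆₂_ f' N
  logSer-hom N = ≋-trans (linear-concatMap Φ-linear (λ n → logCoef n • power _⋆₁_ f (suc n) N) (upTo N))
    (concatMap-cong-≋ (λ n → ≋-trans (linear-• Φ-linear (logCoef n) _) (•-cong (logCoef n) (power-hom (suc n) N)))
      (upTo N))

-- The stuffle side

module Stuffle where

  circ-comm : ∀ x y → circ x y ≋ circ y x
  circ-comm 1̄ 1̄ = ≋-refl
  circ-comm 1̄ (pos n) = ≋-refl
  circ-comm (pos m) 1̄ = ≋-refl
  circ-comm (pos m) (pos n) rewrite ℕP.+-comm m n = ≋-refl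

  circ-assoc : ∀ x y z → bilin circ (bilin circ (single x) (single y)) (single z)
                         ≋ bilin circ (single x) (bilin circ (single y) (single z))
  circ-assoc 1̄ 1̄ 1̄ = ≋-refl
  circ-assoc 1̄ 1̄ (pos n) = mk≋ λ g → cancel (g (+ 0) (pos (suc (suc n)))) (g (+ 1) (pos (suc n)))
    where
    cancel : ∀ a b → 1ℚ ℚ.* a ℚ.+ (1ℚ ℚ.* b ℚ.+ (-1ℚ ℚ.* b ℚ.+ 0ℚ)) ≡ 1ℚ ℚ.* a ℚ.+ 0ℚ
    cancel = solve-∀ ℚ-ring
  circ-assoc 1̄ (pos n) 1̄ = ≋-refl
  circ-assoc (pos n) 1̄ 1̄ = mk≋ λ g → trans (cancel (g (+ 0) (pos (suc (suc n)))) (g (+ 1) (pos (suc n))))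
    (cong (λ k → 1ℚ ℚ.* g (+ 0) (pos (suc k)) ℚ.+ (1ℚ ℚ.* g (+ 1) (pos k) ℚ.+ (-1ℚ ℚ.* g (+ 1) (pos (suc n)) ℚ.+ 0ℚ)))
      (ℕP.+-comm 1 n))
    where
    cancel : ∀ a b → 1ℚ ℚ.* a ℚ.+ 0ℚ ≡ 1ℚ ℚ.* a ℚ.+ (1ℚ ℚ.* b ℚ.+ (-1ℚ ℚ.* b ℚ.+ 0ℚ))
    cancel = solve-∀ ℚ-ring
  circ-assoc 1̄ (pos m) (pos n) = ≋-refl
  circ-assoc (pos m) 1̄ (pos n) = mk≋ λ g →
    cong (λ k → 1ℚ ℚ.* g (+ 0) (pos (suc k)) ℚ.+ (1ℚ ℚ.* g (+ 1) (pos k) ℚ.+ 0ℚ)) (sym (ℕP.+-suc m n))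
  circ-assoc (pos m) (pos n) 1̄ = mk≋ λ g →
    cong (λ k → 1ℚ ℚ.* g (+ 0) (pos (suc k)) ℚ.+ (1ℚ ℚ.* g (+ 1) (pos k) ℚ.+ 0ℚ)) (sym (ℕP.+-suc m n))
  circ-assoc (pos m) (pos n) (pos p) = mk≋ λ g →
    trans (cong (lhs g) (ℕP.+-assoc m n p)) (cong (rhs g) (sym (ℕP.+-suc m (n + p))))
    where
    lhs : (ℤ → ℕ̂ → ℚ) → ℕ → ℚ
    lhs g j = 1ℚ ℚ.* g (+ 0) (pos (suc (suc j))) ℚ.+ (1ℚ ℚ.* g (+ 1) (pos (suc j))
      ℚ.+ (1ℚ ℚ.* g (+ 1) (pos (suc j)) ℚ.+ (1ℚ ℚ.* g (+ 2) (pos j) ℚ.+ 0ℚ)))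
    rhs : (ℤ → ℕ̂ → ℚ) → ℕ → ℚ
    rhs g k = 1ℚ ℚ.* g (+ 0) (pos (suc k)) ℚ.+ (1ℚ ℚ.* g (+ 1) (pos k)
      ℚ.+ (1ℚ ℚ.* g (+ 1) (pos (suc (m + (n + p)))) ℚ.+ (1ℚ ℚ.* g (+ 2) (pos (m + (n + p))) ℚ.+ 0ℚ)))

  open QuasiShuffle ℕ̂ circ
  open Laws circ-comm circ-assoc

  -- e₁̄ ∘ e₁̄ = e₂ - ħ e₁̄ and e₁̄ ∘ e_k = e_{k+1}; the alternating sum telescopes
  -- to a^{j+1} b under the embedding, since e_k = a^k b + ħ a^{k-1} b.
  e₁̄-∘-power : ℕ → Lin ℕ̂
  e₁̄-∘-power zero = single 1̄
  e₁̄-∘-power (suc j) = single (pos (suc j)) ⊕ scale -1ℚ (+ 1) (e₁̄-∘-power j)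

  e₁̄-∘-power-suc : ∀ j → (single 1̄ ∘ e₁̄-∘-power j) ≋ e₁̄-∘-power (suc j)
  e₁̄-∘-power-suc zero = bilin-single circ 1̄ 1̄
  e₁̄-∘-power-suc (suc j) =
    ≋-trans (linear-⊕ (∘-linearʳ (single 1̄)) (single (pos (suc j))) (scale -1ℚ (+ 1) (e₁̄-∘-power j)))
      (⊕-cong (bilin-single circ 1̄ (pos (suc j)))
        (≋-trans (linear-scale (∘-linearʳ (single 1̄)) -1ℚ (+ 1) (e₁̄-∘-power j))
          (scale-cong -1ℚ (+ 1) (e₁̄-∘-power-suc j))))

  open GeometricLog 1̄ e₁̄-∘-power ≋-refl e₁̄-∘-power-suc

  stw≡quasiShuffle : ∀ u v → stw u v ≡ quasiShuffle u v
  stw≡quasiShuffle [] v = refl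
  stw≡quasiShuffle (x ∷ u) [] = refl
  stw≡quasiShuffle (x ∷ u) (y ∷ v)
    rewrite stw≡quasiShuffle u (y ∷ v) | stw≡quasiShuffle (x ∷ u) v | stw≡quasiShuffle u v = refl

  ✱≡⋆ : ∀ p q → (p ✱ q) ≡ (p ⋆ q)
  ✱≡⋆ p q = linExt-cong-≡ (λ u → linExt-cong-≡ (stw≡quasiShuffle u) q) p

  log✱≋log⋆ : ∀ N → logSer _✱_ geomMinus1 N ≋ logSer _⋆_ geometric N
  log✱≋log⋆ = logSer-hom _✱_ _⋆_ ⋆-cong id-linear (λ p q → ≡⇒≋ (✱≡⋆ p q)) ≋-refl geomMinus1 geometric λ where
    zero → ≋-refl
    (suc N) → ≋-refl

  ·-identityʳ : ∀ p → (p · single []) ≋ p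
  ·-identityʳ = linear-ext (bilin-linearˡ (λ u v → single (u ++ v)) (single [])) id-linear
    (λ u → ≋-trans (bilin-single (λ u v → single (u ++ v)) u []) (≡⇒≋ (cong single (ListP.++-identityʳ u))))

  emb-letter : ∀ c → emb (c ▷ single []) ≋ linExt embLetter c
  emb-letter = linear-ext (∘-linear (linExt-linear embWord) (▷-linearˡ (single []))) (linExt-linear embLetter)
    (λ x → ≋-trans (linear-cong (linExt-linear embWord) (single-▷-single x []))
      (≋-trans (linExt-single embWord (x ∷ []))
        (≋-trans (·-identityʳ (embLetter x)) (≋-sym (linExt-single embLetter x)))))

  emb-e₁̄-∘-power : ∀ n → linExt embLetter (e₁̄-∘-power n) ≋ single (replicate (suc n) 𝐚 ++ 𝐛 ∷ [])
  emb-e₁̄-∘-power zero = linExt-single embLetter 1̄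
  emb-e₁̄-∘-power (suc j) = begin
    linExt embLetter (single (pos (suc j)) ⊕ scale -1ℚ (+ 1) (e₁̄-∘-power j))
      ≈⟨ linear-⊕ (linExt-linear embLetter) (single (pos (suc j))) (scale -1ℚ (+ 1) (e₁̄-∘-power j)) ⟩
    linExt embLetter (single (pos (suc j))) ⊕ linExt embLetter (scale -1ℚ (+ 1) (e₁̄-∘-power j))
      ≈⟨ ⊕-cong (linExt-single embLetter (pos (suc j)))
           (≋-trans (linear-scale (linExt-linear embLetter) -1ℚ (+ 1) (e₁̄-∘-power j))
             (scale-cong -1ℚ (+ 1) (emb-e₁̄-∘-power j))) ⟩
    (a^[j+2]b ⊕ scale 1ℚ (+ 1) a^[j+1]b) ⊕ scale -1ℚ (+ 1) a^[j+1]b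
      ≈⟨ ⊕-assoc a^[j+2]b (scale 1ℚ (+ 1) a^[j+1]b) (scale -1ℚ (+ 1) a^[j+1]b) ⟩
    a^[j+2]b ⊕ (scale 1ℚ (+ 1) a^[j+1]b ⊕ scale -1ℚ (+ 1) a^[j+1]b)
      ≈⟨ ⊕-zeroʳ (mk≋ λ g → trans (∫-++ g (scale 1ℚ (+ 1) a^[j+1]b) (scale -1ℚ (+ 1) a^[j+1]b))
           (trans (cong₂ ℚ._+_ (∫-scale g 1ℚ (+ 1) a^[j+1]b) (∫-scale g -1ℚ (+ 1) a^[j+1]b))
             (x-x≡0 (∫ (shift (+ 1) g) a^[j+1]b)))) ⟩
    a^[j+2]b ∎
    where
    open ≋-Reasoning
    a^[j+1]b = single (replicate (suc j) 𝐚 ++ 𝐛 ∷ [])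
    a^[j+2]b = single (replicate (2 + j) 𝐚 ++ 𝐛 ∷ [])
    x-x≡0 : ∀ x → 1ℚ ℚ.* x ℚ.+ -1ℚ ℚ.* x ≡ 0ℚ
    x-x≡0 = solve-∀ ℚ-ring

  emb-logGeometric : ∀ N → emb (logGeometric N) ≋ φ N
  emb-logGeometric zero = ≋-refl
  emb-logGeometric (suc n) = ≋-trans (linear-• (linExt-linear embWord) (logCoef n) (letter n))
    (≋-trans (•-cong (logCoef n) (≋-trans (emb-letter (e₁̄-∘-power n)) (emb-e₁̄-∘-power n)))
      (mk≋ λ g → cong (ℚ._+ 0ℚ) (cong (ℚ._* g (+ 0) (replicate (suc n) 𝐚 ++ 𝐛 ∷ [])) (ℚP.*-identityʳ (logCoef n)))))

  stuffle-log : ∀ N → φ N ≈ emb (logSer _✱_ geomMinus1 N)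
  stuffle-log N = ≋⇒≈ (≋-sym (begin
    emb (logSer _✱_ geomMinus1 N)      ≈⟨ linear-cong (linExt-linear embWord) (log✱≋log⋆ N) ⟩
    emb (logSer _⋆_ geometric N)       ≈⟨ linear-cong (linExt-linear embWord) (log-geometric N) ⟩
    emb (logGeometric N)               ≈⟨ emb-logGeometric N ⟩
    φ N                                ∎))
    where open ≋-Reasoning

-- The shuffle side

replicate-++ : ∀ {A : Set} m n (x : A) → replicate m x ++ replicate n x ≡ replicate (m + n) x
replicate-++ zero n x = refl
replicate-++ (suc m) n x = cong (x ∷_) (replicate-++ m n x)

-- The words a b^{m+1} generate a quasi-shuffle subalgebra of (𝔥, ш): letter m
-- stands for a b^{m+1}, and merging two letters is the ħ-term of the a-rule.
module Shuffle where

  merge : ℕ → ℕ → Lin ℕ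
  merge m n = scale 1ℚ (+ 1) (single (suc (m + n)))

  merge-comm : ∀ m n → merge m n ≋ merge n m
  merge-comm m n rewrite ℕP.+-comm m n = ≋-refl

  merge-assoc : ∀ m n p → bilin merge (bilin merge (single m) (single n)) (single p)
                         ≋ bilin merge (single m) (bilin merge (single n) (single p))
  merge-assoc m n p = mk≋ λ g → cong (λ k → 1ℚ ℚ.* g (+ 2) (suc k) ℚ.+ 0ℚ)
    (trans (cong suc (ℕP.+-assoc m n p)) (sym (ℕP.+-suc m (n + p))))

  open QuasiShuffle ℕ merge
  open Laws merge-comm merge-assoc

  0-∘-power : ℕ → Lin ℕ
  0-∘-power j = scale 1ℚ (+ j) (single j)

  0-∘-power-suc : ∀ j → (single 0 ∘ 0-∘-power j) ≋ 0-∘-power (suc j)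
  0-∘-power-suc j = mk≋ λ g → cong (λ t → 1ℚ ℚ.* g (+ t) (suc j) ℚ.+ 0ℚ) (ℕP.+-comm (j + 0) 1)

  open GeometricLog 0 0-∘-power (•-identityˡ (single 0)) 0-∘-power-suc

  toWord : List ℕ → Word
  toWord [] = []
  toWord (m ∷ u) = 𝐚 ∷ (replicate (suc m) 𝐛 ++ toWord u)

  mapToWord : Lin (List ℕ) → 𝔥
  mapToWord = mapW toWord

  infixr 25 b^_·_
  b^_·_ : ℕ → 𝔥 → 𝔥
  b^ k · p = mapW (replicate k 𝐛 ++_) p

  shw-b^ˡ : ∀ k X Y → shw (replicate k 𝐛 ++ X) Y ≡ b^ k · shw X Y
  shw-b^ˡ zero X Y = sym (ListP.map-id (shw X Y))
  shw-b^ˡ (suc k) X Y = trans (cong (pre 𝐛) (shw-b^ˡ k X Y)) (sym (ListP.map-∘ (shw X Y)))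

  shw-bʳ : ∀ X Y → shw X (𝐛 ∷ Y) ≡ pre 𝐛 (shw X Y)
  shw-bʳ [] Y = refl
  shw-bʳ (𝐛 ∷ X) Y = cong (pre 𝐛) (shw-bʳ X Y)
  shw-bʳ (𝐚 ∷ X) Y = refl

  shw-b^ʳ : ∀ k X Y → shw X (replicate k 𝐛 ++ Y) ≡ b^ k · shw X Y
  shw-b^ʳ zero X Y = sym (ListP.map-id (shw X Y))
  shw-b^ʳ (suc k) X Y = trans (shw-bʳ X (replicate k 𝐛 ++ Y))
    (trans (cong (pre 𝐛) (shw-b^ʳ k X Y)) (sym (ListP.map-∘ (shw X Y))))

  b^-b^ : ∀ m n p → b^ m · b^ n · p ≡ b^ (m + n) · p
  b^-b^ m n p = trans (sym (ListP.map-∘ p)) (ListP.map-cong (λ { (q , k , w) →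
    cong (λ w' → (q , k , w')) (trans (sym (ListP.++-assoc (replicate m 𝐛) (replicate n 𝐛) w))
      (cong (_++ w) (replicate-++ m n 𝐛))) }) p)

  mapToWord-pre : ∀ m p → mapToWord (pre m p) ≡ pre 𝐚 (b^ (suc m) · mapToWord p)
  mapToWord-pre m p = trans (sym (ListP.map-∘ p)) (trans (ListP.map-∘ p) (cong (pre 𝐚) (ListP.map-∘ p)))

  shw-toWord-cons : ∀ m u n v → shw (toWord (m ∷ u)) (toWord (n ∷ v)) ≡
    pre 𝐚 (b^ (suc n) · shw (toWord (m ∷ u)) (toWord v)
      ⊕ (b^ (suc m) · shw (toWord u) (toWord (n ∷ v))
      ⊕ scale 1ℚ (+ 1) (b^ (suc m) · b^ (suc n) · shw (toWord u) (toWord v))))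
  shw-toWord-cons m u n v = cong (pre 𝐚) (cong₂ _⊕_ (shw-b^ʳ (suc n) (toWord (m ∷ u)) (toWord v))
    (cong₂ _⊕_ (shw-b^ˡ (suc m) (toWord u) (toWord (n ∷ v)))
      (cong (scale 1ℚ (+ 1)) (trans (shw-b^ˡ (suc m) (toWord u) (replicate (suc n) 𝐛 ++ toWord v))
        (cong (b^ (suc m) ·_) (shw-b^ʳ (suc n) (toWord u) (toWord v)))))))

  mapToWord-quasiShuffle-cons : ∀ m u n v → mapToWord (quasiShuffle (m ∷ u) (n ∷ v)) ≋
    pre 𝐚 (b^ (suc m) · mapToWord (quasiShuffle u (n ∷ v)))
      ⊕ (pre 𝐚 (b^ (suc n) · mapToWord (quasiShuffle (m ∷ u) v))
      ⊕ pre 𝐚 (scale 1ℚ (+ 1) (b^ (suc m) · b^ (suc n) · mapToWord (quasiShuffle u v))))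
  mapToWord-quasiShuffle-cons m u n v =
    ≋-trans (≡⇒≋ (ListP.map-++ _ (pre m (quasiShuffle u (n ∷ v))) _))
      (⊕-cong (≡⇒≋ (mapToWord-pre m (quasiShuffle u (n ∷ v))))
        (≋-trans (≡⇒≋ (ListP.map-++ _ (pre n (quasiShuffle (m ∷ u) v)) _))
          (⊕-cong (≡⇒≋ (mapToWord-pre n (quasiShuffle (m ∷ u) v))) merged)))
    where
    M = mapToWord (quasiShuffle u v)
    merged : mapToWord (merge m n ▷ quasiShuffle u v) ≋ pre 𝐚 (scale 1ℚ (+ 1) (b^ (suc m) · b^ (suc n) · M))
    merged = begin
      mapToWord (merge m n ▷ quasiShuffle u v)
        ≈⟨ linear-cong (mapW-linear toWord)
             (linear-scale (▷-linearˡ (quasiShuffle u v)) 1ℚ (+ 1) (single (suc (m + n)))) ⟩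
      mapToWord (scale 1ℚ (+ 1) (single (suc (m + n)) ▷ quasiShuffle u v))
        ≈⟨ linear-scale (mapW-linear toWord) 1ℚ (+ 1) _ ⟩
      scale 1ℚ (+ 1) (mapToWord (single (suc (m + n)) ▷ quasiShuffle u v))
        ≈⟨ scale-cong 1ℚ (+ 1) (linear-cong (mapW-linear toWord) (single-▷ (suc (m + n)) (quasiShuffle u v))) ⟩
      scale 1ℚ (+ 1) (mapToWord (pre (suc (m + n)) (quasiShuffle u v)))
        ≈⟨ scale-cong 1ℚ (+ 1) (≡⇒≋ (trans (mapToWord-pre (suc (m + n)) (quasiShuffle u v))
             (cong (pre 𝐚) (trans (cong (b^_· M) (sym (ℕP.+-suc (suc m) n))) (sym (b^-b^ (suc m) (suc n) M)))))) ⟩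
      scale 1ℚ (+ 1) (pre 𝐚 (b^ (suc m) · b^ (suc n) · M))
        ≈⟨ ≋-sym (linear-scale (pre-linear 𝐚) 1ℚ (+ 1) _) ⟩
      pre 𝐚 (scale 1ℚ (+ 1) (b^ (suc m) · b^ (suc n) · M)) ∎
      where open ≋-Reasoning

  shw-toWord : ∀ u v → shw (toWord u) (toWord v) ≋ mapToWord (quasiShuffle u v)
  shw-toWord [] v = ≋-refl
  shw-toWord (m ∷ u) [] = ≋-refl
  shw-toWord (m ∷ u) (n ∷ v) = begin
    shw (toWord (m ∷ u)) (toWord (n ∷ v))
      ≈⟨ ≡⇒≋ (shw-toWord-cons m u n v) ⟩
    pre 𝐚 (b^ (suc n) · S₁ ⊕ (b^ (suc m) · S₂ ⊕ scale 1ℚ (+ 1) (b^ (suc m) · b^ (suc n) · S₃)))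
      ≈⟨ linear-cong (pre-linear 𝐚) (⊕-cong (b^-cong (suc n) (shw-toWord (m ∷ u) v))
           (⊕-cong (b^-cong (suc m) (shw-toWord u (n ∷ v)))
             (scale-cong 1ℚ (+ 1) (b^-cong (suc m) (b^-cong (suc n) (shw-toWord u v)))))) ⟩
    pre 𝐚 (A ⊕ (B ⊕ C))
      ≈⟨ linear-⊕ (pre-linear 𝐚) A (B ⊕ C) ⟩
    pre 𝐚 A ⊕ pre 𝐚 (B ⊕ C)
      ≈⟨ ⊕-congʳ (pre 𝐚 A) (linear-⊕ (pre-linear 𝐚) B C) ⟩
    pre 𝐚 A ⊕ (pre 𝐚 B ⊕ pre 𝐚 C)
      ≈⟨ ⊕-swap (pre 𝐚 A) (pre 𝐚 B) (pre 𝐚 C) ⟩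
    pre 𝐚 B ⊕ (pre 𝐚 A ⊕ pre 𝐚 C)
      ≈⟨ ≋-sym (mapToWord-quasiShuffle-cons m u n v) ⟩
    mapToWord (quasiShuffle (m ∷ u) (n ∷ v)) ∎
    where
    open ≋-Reasoning
    S₁ = shw (toWord (m ∷ u)) (toWord v)
    S₂ = shw (toWord u) (toWord (n ∷ v))
    S₃ = shw (toWord u) (toWord v)
    A = b^ (suc n) · mapToWord (quasiShuffle (m ∷ u) v)
    B = b^ (suc m) · mapToWord (quasiShuffle u (n ∷ v))
    C = scale 1ℚ (+ 1) (b^ (suc m) · b^ (suc n) · mapToWord (quasiShuffle u v))
    b^-cong : ∀ k {p r} → p ≋ r → b^ k · p ≋ b^ k · r
    b^-cong k = linear-cong (mapW-linear (replicate k 𝐛 ++_))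

  mapToWord-⋆ : ∀ p q → mapToWord (p ⋆ q) ≋ (mapToWord p ш mapToWord q)
  mapToWord-⋆ p q =
    linear-ext (∘-linear (mapW-linear toWord) (⋆-linearˡ q))
               (∘-linear (bilin-linearˡ shw (mapToWord q)) (mapW-linear toWord))
      (λ u → linear-ext (∘-linear (mapW-linear toWord) (⋆-linearʳ (single u)))
                        (∘-linear (bilin-linearʳ shw (single (toWord u))) (mapW-linear toWord))
        (λ v → ≋-trans (linear-cong (mapW-linear toWord) (single-⋆-single u v))
          (≋-trans (≋-sym (shw-toWord u v)) (≋-sym (bilin-single shw (toWord u) (toWord v))))) q) p

  embWord-e₁̄^ : ∀ k → embWord (replicate k 1̄) ≋ single (toWord (replicate k 0))
  embWord-e₁̄^ zero = ≋-refl
  embWord-e₁̄^ (suc k) =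
    ≋-trans (linear-cong (bilin-linearʳ (λ u v → single (u ++ v)) (single (𝐚 ∷ 𝐛 ∷ []))) (embWord-e₁̄^ k))
      (bilin-single (λ u v → single (u ++ v)) (𝐚 ∷ 𝐛 ∷ []) (toWord (replicate k 0)))

  mapToWord-geometric : ∀ N → mapToWord (geometric N) ≋ geomMinus1𝔥 N
  mapToWord-geometric zero = ≋-refl
  mapToWord-geometric (suc n) =
    ≋-sym (≋-trans (linExt-single embWord (replicate (suc n) 1̄)) (embWord-e₁̄^ (suc n)))

  mapToWord-logGeometric : ∀ N → mapToWord (logGeometric N) ≋ ψ N
  mapToWord-logGeometric zero = ≋-refl
  mapToWord-logGeometric (suc n) = ≋-trans (linear-• (mapW-linear toWord) (logCoef n) (letter n))
    (≋-trans (•-cong (logCoef n) (linear-cong (mapW-linear toWord)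
       (≋-trans (linear-scale (▷-linearˡ (single [])) 1ℚ (+ n) (single n))
         (scale-cong 1ℚ (+ n) (single-▷-single n [])))))
    (mk≋ λ g → cong₂ (λ a b → a ℚ.* b ℚ.+ 0ℚ) (ℚP.*-identityʳ (logCoef n))
      (cong₂ g (cong +_ (ℕP.+-identityʳ n)) (cong (𝐚 ∷_) (ListP.++-identityʳ (replicate (suc n) 𝐛))))))

  shuffle-log : ∀ N → ψ N ≈ logSer _ш_ geomMinus1𝔥 N
  shuffle-log N = ≋⇒≈ (begin
    ψ N                                   ≈⟨ ≋-sym (mapToWord-logGeometric N) ⟩
    mapToWord (logGeometric N)            ≈⟨ linear-cong (mapW-linear toWord) (≋-sym (log-geometric N)) ⟩
    mapToWord (logSer _⋆_ geometric N)
      ≈⟨ logSer-hom _⋆_ _ш_ (bilin-cong shw) (mapW-linear toWord) mapToWord-⋆ ≋-refl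
           geometric geomMinus1𝔥 mapToWord-geometric N ⟩
    logSer _ш_ geomMinus1𝔥 N              ∎)
    where open ≋-Reasoning

proposition3p1 : (∀ (N : ℕ) → ψ N ≈ logSer _ш_ geomMinus1𝔥 N)
    × (∀ (N : ℕ) → φ N ≈ emb (logSer _✱_ geomMinus1 N))
proposition3p1 = Shuffle.shuffle-log , Stuffle.stuffle-log
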